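{- Let $p$ be a prime, let $\alpha \geq 0$ be an integer, and let $n \geq 0$ be an integer with base-$p$ representation $n_l n_{l-1} \cdots n_0$. Let $a_{p^\alpha}(n)$ be the number of integers $0 \leq m \leq n$ such that $\binom{n}{m} \not\equiv 0 \pmod{p^\alpha}$. Then \[ a_{p^\alpha}(n) = \left(\prod_{i=0}^l \left(n_i + 1\right)\right) \sum_{\gamma = 0}^{2 (\alpha - 1)} \sum_{P \in S_\alpha(\gamma)} \sum_{\{v, w, \dots, z\} \in N_P(n)} c(v) c(w) \cdots c(z), \] where $S_\alpha(\gamma)$, $N_P(n)$ and $c$ are as defined in the context.
   Context: For a nonnegative integer $n$, $n_l n_{l-1}\cdots n_0$ denotes its standard base-$p$ digits (with $n_l \neq 0$); the representation of $0$ is the empty word. Conventions: an empty sum is $0$, an empty product is $1$, and there is exactly one integer partition of $0$ (the empty partition). For a word $w_k w_{k-1} \cdots w_0$ with $k \geq 1$ over the alphabet $\{0,1,\dots,p-1\}$, define the rational number \[ c(w_k w_{k-1} \cdots w_0) = \frac{w_k}{w_k + 1} \cdot \left(\prod_{h=1}^{k-1} \frac{p - w_{k-h}}{w_{k-h} + 1} \right) \cdot \frac{p - w_0 - 1}{w_0 + 1}. \] For a nonnegative integer $\gamma$, $S_\alpha(\gamma)$ is the set of integer partitions of $\gamma$ into at least $\max(0, \gamma - (\alpha - 1))$ parts, all parts of size at least $2$. For an integer partition $P$ with $|P|$ parts, $N_P(n)$ denotes the collection of sets of $|P|$ pairwise nonoverlapping contiguous subwords of $n_l n_{l-1}\cdots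 n_0$ (a subword being specified by its pair of start and end positions $n_i n_{i-1}\cdots n_f$, two subwords being distinct exactly when their position pairs differ, and nonoverlapping meaning their position intervals are disjoint) such that the multiset of lengths of the subwords equals $P$. The inner sum is over all such sets, with $c$ applied to each subword. -}

module Defs where

open import Data.Nat as ℕ using (ℕ; zero; suc; _+_; _*_; _∸_; _^_; _≤_; _<_; _>_)
open import Data.Nat.DivMod using (_/_; _%_)
open import Data.Nat.Divisibility using (_∣?_)
open import Data.Nat.Combinatorics using (_C_)
open import Data.Integer using (+_)
open import Data.Rational as ℚ using (ℚ; 0ℚ; 1ℚ)
open import Data.Nat.ListAction using (sum)
open import Data.List using (List; []; _∷_; length; filter; upTo; map; take; drop; reverse; foldr)
open import Data.List.Relation.Unary.All using (All)
open import Data.List.Relation.Binary.Permutation.Propositional using (_↭_)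
open import Data.Product using (_×_; _,_)
open import Relation.Nullary.Decidable using (¬?)
open import Relation.Binary.PropositionalEquality using (_≡_)

-- base-p digits, little-endian: digits p n = [n₀, n₁, …, n_l]; digits p 0 = [].
-- (fuel n suffices; for p < 2, which is excluded by primality, we return []).
digitsAux : ℕ → ℕ → ℕ → List ℕ
digitsAux (suc (suc b)) (suc fuel) (suc m) =
  (suc m % suc (suc b)) ∷ digitsAux (suc (suc b)) fuel (suc m / suc (suc b))
digitsAux _ _ _ = []

digits : ℕ → ℕ → List ℕ
digits p n = digitsAux p n n

a : ℕ → ℕ → ℕ → ℕ
a p α n = length (filter (λ m → ¬? ((p ^ α) ∣? (n C m))) (upTo (suc n)))

Σℚ : List ℚ → ℚ
Σℚ = foldr ℚ._+_ 0ℚ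

Πℚ : List ℚ → ℚ
Πℚ = foldr ℚ._*_ 1ℚ

-- c applied to the tail w_{k-1} … w_0 (big-endian)
cTail : ℕ → List ℕ → ℚ
cTail p [] = 1ℚ
cTail p (w0 ∷ []) = (+ (p ∸ w0 ∸ 1)) ℚ./ suc w0
cTail p (w ∷ w' ∷ ws) = ((+ (p ∸ w)) ℚ./ suc w) ℚ.* cTail p (w' ∷ ws)

-- c(w_k w_{k-1} … w_0), word given big-endian (first element is w_k);
-- only meaningful for k ≥ 1 (words of length ≥ 2), which is the only use.
c : ℕ → List ℕ → ℚ
c p [] = 0ℚ
c p (wk ∷ []) = 0ℚ
c p (wk ∷ w ∷ ws) = ((+ wk) ℚ./ suc wk) ℚ.* cTail p (w ∷ ws)

-- A subword n_i n_{i-1} … n_f is given by its position pair (i , f), f ≤ i.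
lengthSW : ℕ × ℕ → ℕ
lengthSW (i , f) = suc (i ∸ f)

subword : List ℕ → ℕ × ℕ → List ℕ
subword ds (i , f) = reverse (take (suc (i ∸ f)) (drop f ds))

-- Integer partitions, canonically represented as nonincreasing lists of positive parts.
data NonIncr : List ℕ → Set where
  []  : NonIncr []
  [_] : ∀ x → NonIncr (x ∷ [])
  _∷_ : ∀ {x y ys} → y ≤ x → NonIncr (y ∷ ys) → NonIncr (x ∷ y ∷ ys)

-- P ∈ S_α(γ): P a partition of γ, all parts ≥ 2, and
-- (number of parts) ≥ γ - (α - 1) (as integers), i.e. |P| + α ≥ γ + 1.
record InS (α γ : ℕ) (P : List ℕ) : Set where
  field
    sorted   : NonIncr P
    parts≥2  : All (λ x → 2 ≤ x) P
    sums     : sum P ≡ γ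
    enough   : γ + 1 ≤ length P + α

-- A set of pairwise nonoverlapping subwords of a word of length L, canonically
-- represented as a list of position pairs (i , f) listed from the most significant
-- end: each f ≤ i < L, and each subword lies strictly above the next one (f > i').
data Chain (L : ℕ) : List (ℕ × ℕ) → Set where
  []  : Chain L []
  [_] : ∀ {i f} → f ≤ i × i < L → Chain L ((i , f) ∷ [])
  _∷_ : ∀ {i f i' f' rest} → f ≤ i × i < L × i' < f →
        Chain L ((i' , f') ∷ rest) → Chain L ((i , f) ∷ (i' , f') ∷ rest)

record InN (p n : ℕ) (P : List ℕ) (Q : List (ℕ × ℕ)) : Set where
  field
    nonoverlap : Chain (length (digits p n)) Q
    lengths    : map lengthSW Q ↭ P

toℚ : ℕ → ℚ
toℚ k = (+ k) ℚ./ 1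

-- By Kummer's theorem, p ^ α ∤ (n choose m) iff fewer than α carries occur when m and n − m
-- are added in base p.  Reading n from its least significant digit, a digit n_i admits
-- n_i + 1 − c digits of m producing no carry and p − n_i − 1 + c producing one (c the incoming
-- carry), so a_{p^α}(n) is a product of 2 × 2 transfer matrices.  Expanding that product from
-- the most significant end instead, a maximal run of carries leaving positions f, …, i − 1 has
-- weight n_i ∏_{f<j<i} (p − n_j) (p − n_f − 1) and costs i − f carries, every other position
-- has weight n_j + 1; relative to ∏ (n_j + 1) the run weighs c(n_i ⋯ n_f).  So a_{p^α}(n) is
-- ∏ (n_j + 1) times the sum, over families of disjoint subwords of total cost below α, of the
-- products of their c-values, and these families are exactly the N_P(n) with P ∈ S_α(γ).

module Submission where

open import Algebra.Bundles using (CommutativeMonoid)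
open import Data.Bool.Base using (Bool; true; false; if_then_else_)
open import Data.Empty using (⊥; ⊥-elim)
import Data.Integer.Base as ℤ
import Data.Integer.Properties as ℤ
import Data.Integer.Tactic.RingSolver as ℤ
open import Data.List.Base using (List; []; _∷_; _++_; length; take; drop; reverse; map; filter; applyUpTo; upTo; concatMap)
import Data.List.Properties as List
open import Data.List.Properties using (map-++; reverse-++; length-drop)
open import Data.List.Membership.Propositional using (_∈_; find; lose)
open import Data.List.Membership.Propositional.Properties using (∈-++⁻; ∈-++⁺ˡ; ∈-++⁺ʳ; ∈-map⁻; ∈-map⁺; ∈-upTo⁺; ∈-concatMap⁺; ∈-concatMap⁻)
open import Data.List.Membership.Propositional.Properties.WithK using (unique∧set⇒bag)
open import Data.List.Relation.Binary.BagAndSetEquality using (∼bag⇒↭)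
open import Data.List.Relation.Binary.Permutation.Propositional using (_↭_; ↭-sym; ↭-trans; ↭⇒↭ₛ)
open import Data.List.Relation.Binary.Permutation.Propositional.Properties using (All-resp-↭; ↭-length)
import Data.List.Relation.Binary.Permutation.Propositional.Properties as ↭
open import Data.List.Relation.Binary.Permutation.Setoid.Properties using (foldr-commMonoid)
open import Data.List.Relation.Unary.All as All using (All; []; _∷_)
open import Data.List.Relation.Unary.AllPairs using ([]; _∷_)
open import Data.List.Relation.Unary.Any using (here; there)
open import Data.List.Relation.Unary.Unique.Propositional using (Unique)
import Data.List.Relation.Unary.Unique.Propositional.Properties as Unique
open import Data.Nat.Base
open import Data.Nat.Combinatorics using (_C_; nCk≡n!/k![n-k]!; k![n∸k]!∣n!)
open import Data.Nat.DivMod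
open import Data.Nat.Divisibility
open import Data.Nat.Induction using (<-wellFounded)
open import Data.Nat.ListAction using (sum; product)
open import Data.Nat.ListAction.Properties using (sum-↭; product-++)
open import Data.Nat.Primality using (Prime; euclidsLemma; prime⇒nonZero; prime⇒nonTrivial)
open import Data.Nat.Properties
open import Algebra.Properties.CommutativeSemigroup *-commutativeSemigroup using (interchange; xy∙z≈zx∙y)
open import Algebra.Properties.CommutativeSemigroup +-commutativeSemigroup using () renaming (interchange to +-interchange)
open import Data.Nat.Tactic.RingSolver using (solve-∀)
open import Data.Product using (_×_; _,_; proj₁; proj₂; ∃-syntax)
open import Data.Rational.Base as ℚ using (ℚ; toℚᵘ) renaming (_+_ to _+ℚ_; _*_ to _*ℚ_)
import Data.Rational.Properties as ℚ
open import Data.Rational.Solver using (module +-*-Solver)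
import Data.Rational.Unnormalised.Base as ℚᵘ
import Data.Rational.Unnormalised.Properties as ℚᵘ
open import Data.Sum using ([_,_]′; inj₁; inj₂)
open import Defs
open import Function.Base using (_∘_; _∘′_; id)
open import Function.Bundles using (_⇔_; mk⇔; Equivalence)
open import Induction.WellFounded using (Acc; acc)
open import Relation.Binary.PropositionalEquality
open import Relation.Nullary using (Dec; does; yes; no; ¬?)
open import Relation.Nullary.Decidable using (dec-true; dec-false)
open import Relation.Unary using (Pred; Decidable)

toℕ : Bool → ℕ
toℕ false = 0
toℕ true  = 1

toℕ≤1 : ∀ c → toℕ c ≤ 1
toℕ≤1 false = z≤n
toℕ≤1 true  = s≤s z≤n

[1+m+n]∸[m+o]≡1+[n∸o] : ∀ m {n o} → o ≤ n → suc m + n ∸ (m + o) ≡ suc (n ∸ o)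
[1+m+n]∸[m+o]≡1+[n∸o] m {n} {o} o≤n =
  trans (cong (_∸ (m + o)) (sym (+-suc m n))) (trans ([m+n]∸[m+o]≡n∸o m (suc n) o) (+-∸-assoc 1 o≤n))

m+n+o≡q⇒q∸m∸n≡o : ∀ {m n o q} → m + n + o ≡ q → q ∸ m ∸ n ≡ o
m+n+o≡q⇒q∸m∸n≡o {m} {n} {o} refl = trans (∸-+-assoc (m + n + o) m n) (m+n∸m≡n (m + n) o)

∸-∸-comm : ∀ m n → m ∸ 1 ∸ n ≡ m ∸ n ∸ 1
∸-∸-comm m n = trans (∸-+-assoc m 1 n) (trans (cong (m ∸_) (+-comm 1 n)) (sym (∸-+-assoc m n 1)))

+<⇒<∸ : ∀ a x β → a + x < β → x < β ∸ a
+<⇒<∸ a x β a+x<β = m+n≤o⇒m≤o∸n (suc x) (subst (_≤ β) (cong suc (+-comm a x)) a+x<β)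

<∸⇒+< : ∀ a x β → x < β ∸ a → a + x < β
<∸⇒+< a x β x<β∸a = subst (_≤ β) (cong suc (+-comm x a)) (m≤o∸n⇒m+n≤o (suc x) a≤β x<β∸a)
  where
  a≤β : a ≤ β
  a≤β = <⇒≤ (m∸n≢0⇒n<m (λ β∸a≡0 → n≮0 (subst (x <_) β∸a≡0 x<β∸a)))

2*e<2*α∸1 : ∀ {e α} → e < α → 2 * e < 2 * α ∸ 1
2*e<2*α∸1 {e} e<α = <-≤-trans (+-monoʳ-< e (n<1+n (e + 0))) (∸-monoˡ-≤ 1 (*-monoʳ-≤ 2 e<α))

∑< : ℕ → (ℕ → ℕ) → ℕ
∑< zero    f = 0
∑< (suc k) f = ∑< k f + f k

syntax ∑< k (λ i → e) = ∑[ i < k ] e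

∑<-cong : ∀ {f g} k → (∀ {i} → i < k → f i ≡ g i) → ∑< k f ≡ ∑< k g
∑<-cong zero    f≗g = refl
∑<-cong (suc k) f≗g = cong₂ _+_ (∑<-cong k (f≗g ∘ m<n⇒m<1+n)) (f≗g ≤-refl)

∑<-+ : ∀ f j k → ∑< (j + k) f ≡ ∑< j f + ∑[ i < k ] f (j + i)
∑<-+ f j zero    = trans (cong (λ n → ∑< n f) (+-identityʳ j)) (sym (+-identityʳ (∑< j f)))
∑<-+ f j (suc k) = begin
  ∑< (j + suc k) f                                     ≡⟨ cong (λ n → ∑< n f) (+-suc j k) ⟩
  ∑< (j + k) f + f (j + k)                             ≡⟨ cong (_+ f (j + k)) (∑<-+ f j k) ⟩
  ∑< j f + ∑[ i < k ] f (j + i) + f (j + k)            ≡⟨ +-assoc (∑< j f) _ _ ⟩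
  ∑< j f + ∑[ i < suc k ] f (j + i)                    ∎
  where open ≡-Reasoning

∑<-const : ∀ k x → ∑[ _ < k ] x ≡ k * x
∑<-const zero    x = refl
∑<-const (suc k) x = trans (cong (_+ x) (∑<-const k x)) (+-comm (k * x) x)

∑<-distrib-+ : ∀ f g k → ∑[ i < k ] (f i + g i) ≡ ∑< k f + ∑< k g
∑<-distrib-+ f g zero    = refl
∑<-distrib-+ f g (suc k) = trans (cong (_+ (f k + g k)) (∑<-distrib-+ f g k)) (+-interchange (∑< k f) (∑< k g) (f k) (g k))

∑<-distribˡ-* : ∀ x f k → ∑[ i < k ] (x * f i) ≡ x * ∑< k f
∑<-distribˡ-* x f zero    = sym (*-zeroʳ x)
∑<-distribˡ-* x f (suc k) = trans (cong (_+ x * f k) (∑<-distribˡ-* x f k)) (sym (*-distribˡ-+ x (∑< k f) (f k)))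

∑<-blocks : ∀ f N b → ∑< (N * b) f ≡ ∑[ M < N ] ∑[ r < b ] f (r + M * b)
∑<-blocks f zero    b = refl
∑<-blocks f (suc N) b = begin
  ∑< (b + N * b) f                                        ≡⟨ cong (λ n → ∑< n f) (+-comm b (N * b)) ⟩
  ∑< (N * b + b) f                                        ≡⟨ ∑<-+ f (N * b) b ⟩
  ∑< (N * b) f + ∑[ r < b ] f (N * b + r)                 ≡⟨ cong₂ _+_ (∑<-blocks f N b) (∑<-cong b (λ {r} _ → cong f (+-comm (N * b) r))) ⟩
  ∑[ M < N ] ∑[ r < b ] f (r + M * b) + ∑[ r < b ] f (r + N * b) ∎
  where open ≡-Reasoning

𝟙 : ∀ {P : Set} → Dec P → ℕ
𝟙 P? = if does P? then 1 else 0

𝟙-cong : ∀ {P Q : Set} → P ⇔ Q → (P? : Dec P) (Q? : Dec Q) → 𝟙 P? ≡ 𝟙 Q?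
𝟙-cong P⇔Q (yes P) Q? rewrite dec-true Q? (Equivalence.to P⇔Q P)     = refl
𝟙-cong P⇔Q (no ¬P) Q? rewrite dec-false Q? (¬P ∘ Equivalence.from P⇔Q) = refl

𝟙-suc< : ∀ x α → 𝟙 (suc x <? α) ≡ 𝟙 (x <? α ∸ 1)
𝟙-suc< x zero    = refl
𝟙-suc< x (suc α) = refl

length-filter-applyUpTo : ∀ {P : Pred ℕ _} (P? : Decidable P) f k →
                          length (filter P? (applyUpTo f k)) ≡ ∑[ i < k ] 𝟙 (P? (f i))
length-filter-applyUpTo P? f zero    = refl
length-filter-applyUpTo P? f (suc k) = trans unfold (sym (∑<-+ (λ i → 𝟙 (P? (f i))) 1 k))
  where
  unfold : length (filter P? (applyUpTo f (suc k))) ≡ 𝟙 (P? (f 0)) + ∑[ i < k ] 𝟙 (P? (f (suc i)))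
  unfold with does (P? (f 0))
  ... | false = length-filter-applyUpTo P? (f ∘ suc) k
  ... | true  = cong suc (length-filter-applyUpTo P? (f ∘ suc) k)

digitsAux-fuel : ∀ b {f g} m → m ≤ f → m ≤ g → digitsAux (2 + b) f m ≡ digitsAux (2 + b) g m
digitsAux-fuel b {f} {g} zero _ _ = trans (vanishes f) (sym (vanishes g))
  where
  vanishes : ∀ f → digitsAux (2 + b) f 0 ≡ []
  vanishes zero    = refl
  vanishes (suc f) = refl
digitsAux-fuel b {suc f} {suc g} (suc m) (s≤s m≤f) (s≤s m≤g) =
  cong (suc m % (2 + b) ∷_) (digitsAux-fuel b (suc m / (2 + b)) (≤-trans m/p≤m m≤f) (≤-trans m/p≤m m≤g))
  where
  m/p≤m : suc m / (2 + b) ≤ m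
  m/p≤m = ≤-pred (m/n<m (suc m) (2 + b) (s≤s (s≤s z≤n)))

digits-zero : ∀ p → digits p 0 ≡ []
digits-zero zero          = refl
digits-zero (suc zero)    = refl
digits-zero (suc (suc b)) = refl

digits-suc : ∀ p .{{_ : NonZero p}} → 1 < p → ∀ n → digits p (suc n) ≡ suc n % p ∷ digits p (suc n / p)
digits-suc (suc (suc b)) _ n =
  cong (suc n % (2 + b) ∷_) (digitsAux-fuel b (suc n / (2 + b)) (≤-pred (m/n<m (suc n) (2 + b) (s≤s (s≤s z≤n)))) ≤-refl)
digits-suc (suc zero) (s≤s ()) n

digitAt : List ℕ → ℕ → ℕ
digitAt []       _       = 0
digitAt (d ∷ ds) zero    = d
digitAt (d ∷ ds) (suc i) = digitAt ds i

take-suc : ∀ (ds : List ℕ) L → L < length ds → take (suc L) ds ≡ take L ds ++ digitAt ds L ∷ []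
take-suc (d ∷ ds) zero    _          = refl
take-suc (d ∷ ds) (suc L) (s≤s L<n) = cong (d ∷_) (take-suc ds L L<n)

digitAt-drop : ∀ (ds : List ℕ) f i → digitAt (drop f ds) i ≡ digitAt ds (f + i)
digitAt-drop ds       zero    i = refl
digitAt-drop []       (suc f) i = refl
digitAt-drop (d ∷ ds) (suc f) i = digitAt-drop ds f i

toℚᵘ-toℚ : ∀ k → toℚᵘ (toℚ k) ℚᵘ.≃ ℚᵘ.mkℚᵘ (ℤ.+ k) 0
toℚᵘ-toℚ k = ℚ.toℚᵘ-fromℚᵘ (ℚᵘ.mkℚᵘ (ℤ.+ k) 0)

toℚ-+ : ∀ m n → toℚ (m + n) ≡ toℚ m +ℚ toℚ n
toℚ-+ m n = ℚ.toℚᵘ-injective (ℚᵘ.≃-trans (toℚᵘ-toℚ (m + n)) (ℚᵘ.≃-sym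
  (ℚᵘ.≃-trans (ℚ.toℚᵘ-homo-+ (toℚ m) (toℚ n))
  (ℚᵘ.≃-trans (ℚᵘ.+-cong (toℚᵘ-toℚ m) (toℚᵘ-toℚ n)) (ℚᵘ.*≡* (sums (ℤ.+ m) (ℤ.+ n)))))))
  where
  sums : ∀ x y → (x ℤ.* ℤ.+ 1 ℤ.+ y ℤ.* ℤ.+ 1) ℤ.* ℤ.+ 1 ≡ (x ℤ.+ y) ℤ.* ℤ.+ 1
  sums = ℤ.solve-∀

toℚ-* : ∀ m n → toℚ (m * n) ≡ toℚ m *ℚ toℚ n
toℚ-* m n = ℚ.toℚᵘ-injective (ℚᵘ.≃-trans (toℚᵘ-toℚ (m * n)) (ℚᵘ.≃-sym
  (ℚᵘ.≃-trans (ℚ.toℚᵘ-homo-* (toℚ m) (toℚ n))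
  (ℚᵘ.≃-trans (ℚᵘ.*-cong (toℚᵘ-toℚ m) (toℚᵘ-toℚ n)) (ℚᵘ.*≡* (cong (ℤ._* ℤ.+ 1) (sym (ℤ.pos-* m n))))))))

toℚ-*-/ : ∀ a d → toℚ (suc d) *ℚ (ℤ.+ a ℚ./ suc d) ≡ toℚ a
toℚ-*-/ a d = ℚ.toℚᵘ-injective (ℚᵘ.≃-trans (ℚ.toℚᵘ-homo-* (toℚ (suc d)) (ℤ.+ a ℚ./ suc d))
  (ℚᵘ.≃-trans (ℚᵘ.*-cong (toℚᵘ-toℚ (suc d)) (ℚ.toℚᵘ-fromℚᵘ (ℚᵘ.mkℚᵘ (ℤ.+ a) d)))
  (ℚᵘ.≃-trans (ℚᵘ.*≡* (cancel (ℤ.+ suc d) (ℤ.+ a))) (ℚᵘ.≃-sym (toℚᵘ-toℚ a)))))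
  where
  cancel : ∀ x y → (x ℤ.* y) ℤ.* ℤ.+ 1 ≡ y ℤ.* (ℤ.+ 1 ℤ.* x)
  cancel = ℤ.solve-∀

Σℚ-map-++ : ∀ {A : Set} (h : A → ℚ) xs ys → Σℚ (map h (xs ++ ys)) ≡ Σℚ (map h xs) +ℚ Σℚ (map h ys)
Σℚ-map-++ h []       ys = sym (ℚ.+-identityˡ _)
Σℚ-map-++ h (x ∷ xs) ys = trans (cong (h x +ℚ_) (Σℚ-map-++ h xs ys)) (sym (ℚ.+-assoc (h x) _ _))

Σℚ-↭ : ∀ {xs ys} → xs ↭ ys → Σℚ xs ≡ Σℚ ys
Σℚ-↭ xs↭ys = foldr-commMonoid ℚ+.setoid ℚ+.isCommutativeMonoid (↭⇒↭ₛ xs↭ys)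
  where module ℚ+ = CommutativeMonoid ℚ.+-0-commutativeMonoid

Σℚ-map-unique : ∀ {A : Set} (h : A → ℚ) {xs ys} → Unique xs → Unique ys → (∀ {x} → x ∈ xs ⇔ x ∈ ys) →
                Σℚ (map h xs) ≡ Σℚ (map h ys)
Σℚ-map-unique h ux uy xs⇔ys = Σℚ-↭ (↭.map⁺ h (∼bag⇒↭ (unique∧set⇒bag ux uy xs⇔ys)))

Σℚ-map-concatMap : ∀ {A B : Set} (h : B → ℚ) (g : A → List B) xs →
                   Σℚ (map h (concatMap g xs)) ≡ Σℚ (map (λ x → Σℚ (map h (g x))) xs)
Σℚ-map-concatMap h g []       = refl
Σℚ-map-concatMap h g (x ∷ xs) = trans (Σℚ-map-++ h (g x) (concatMap g xs)) (cong (Σℚ (map h (g x)) +ℚ_) (Σℚ-map-concatMap h g xs))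

∈-concatMap⇔ : ∀ {A B : Set} (g : A → List B) {xs z} → z ∈ concatMap g xs ⇔ (∃[ x ] x ∈ xs × z ∈ g x)
∈-concatMap⇔ g = mk⇔ (find ∘ ∈-concatMap⁻ g) (λ (x , x∈ , z∈) → ∈-concatMap⁺ g (lose x∈ z∈))

concatMap-unique : ∀ {A B : Set} (g : A → List B) {xs} → Unique xs → (∀ {x} → x ∈ xs → Unique (g x)) →
                   (∀ {x x′ z} → x ∈ xs → x′ ∈ xs → z ∈ g x → z ∈ g x′ → x ≡ x′) → Unique (concatMap g xs)
concatMap-unique g {[]}     _           _       _   = []
concatMap-unique g {x ∷ xs} (x∉ ∷ uxs) unique-g det =
  Unique.++⁺ (unique-g (here refl)) (concatMap-unique g uxs (unique-g ∘ there) (λ y∈ y′∈ → det (there y∈) (there y′∈))) disjoint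
  where
  disjoint : ∀ {z} → z ∈ g x × z ∈ concatMap g xs → ⊥
  disjoint (z∈gx , z∈rest) with Equivalence.to (∈-concatMap⇔ g) z∈rest
  ... | x′ , x′∈ , z∈gx′ = All.lookup x∉ x′∈ (det (here refl) (there x′∈) z∈gx z∈gx′)

module Descending where
  open import Relation.Binary.Bundles using (DecTotalOrder)
  open import Relation.Binary.Properties.DecTotalOrder ≤-decTotalOrder using (≥-decTotalOrder)
  open import Data.List.Sort ≥-decTotalOrder using (sort; sort-↭; sort-↗)
  open import Data.List.Relation.Unary.Sorted.TotalOrder (DecTotalOrder.totalOrder ≥-decTotalOrder) using (Sorted)
  open import Data.List.Relation.Unary.Sorted.TotalOrder.Properties using (↗↭↗⇒≋)
  open import Data.List.Relation.Unary.Linked using ([]; [-]; _∷_)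
  open import Data.List.Relation.Binary.Pointwise using (Pointwise-≡⇒≡)
  import Data.List.Relation.Binary.Permutation.Homogeneous as Homogeneous

  sorted⇒nonIncr : ∀ {xs} → Sorted xs → NonIncr xs
  sorted⇒nonIncr []          = []
  sorted⇒nonIncr ([-] {x})   = [ x ]
  sorted⇒nonIncr (y≤x ∷ ys)  = y≤x ∷ sorted⇒nonIncr ys

  nonIncr⇒sorted : ∀ {xs} → NonIncr xs → Sorted xs
  nonIncr⇒sorted []          = []
  nonIncr⇒sorted [ x ]       = [-]
  nonIncr⇒sorted (y≤x ∷ ys)  = y≤x ∷ nonIncr⇒sorted ys

  nonIncr-↭⇒≡ : ∀ {xs ys} → NonIncr xs → NonIncr ys → xs ↭ ys → xs ≡ ys
  nonIncr-↭⇒≡ xs↘ ys↘ xs↭ys = Pointwise-≡⇒≡ (↗↭↗⇒≋ (DecTotalOrder.totalOrder ≥-decTotalOrder)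
    (nonIncr⇒sorted xs↘) (nonIncr⇒sorted ys↘) (Homogeneous.map id (↭⇒↭ₛ xs↭ys)))

  sortDesc : List ℕ → List ℕ
  sortDesc = sort

  sortDesc-↭ : ∀ xs → sortDesc xs ↭ xs
  sortDesc-↭ = sort-↭

  sortDesc-nonIncr : ∀ xs → NonIncr (sortDesc xs)
  sortDesc-nonIncr xs = sorted⇒nonIncr (sort-↗ xs)

Subwords : Set
Subwords = List (ℕ × ℕ)

excess : Subwords → ℕ
excess []            = 0
excess ((i , f) ∷ Q) = (i ∸ f) + excess Q

-- With L the number of digits of n, Q ∈ N_P(n) for some P ∈ S_α(γ) iff Admissible L α Q,
-- with P the sorted lengths of Q: |P| ≥ γ − (α − 1) says exactly that excess Q < α.
record Admissible (L β : ℕ) (Q : Subwords) : Set where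
  constructor admissible
  field
    chain     : Chain L Q
    long      : All (λ v → proj₂ v < proj₁ v) Q
    excess<β  : excess Q < β

-- chains L β lists the admissible sets of subwords below position L; headed i F β lists
-- those (i , f) ∷ Q with f < F and Q admissible below f.
chains : ℕ → ℕ → List Subwords
headed : ℕ → ℕ → ℕ → List Subwords
chains zero    zero    = []
chains zero    (suc β) = [] ∷ []
chains (suc L) β       = chains L β ++ headed L L β
headed i zero    β = []
headed i (suc f) β = headed i f β ++ map ((i , f) ∷_) (chains f (β ∸ (i ∸ f)))

chain-weaken : ∀ {L L′ Q} → L ≤ L′ → Chain L Q → Chain L′ Q
chain-weaken L≤L′ []                  = []
chain-weaken L≤L′ [ f≤i , i<L ]       = [ f≤i , <-≤-trans i<L L≤L′ ]
chain-weaken L≤L′ ((f≤i , i<L , j<f) ∷ ch) = (f≤i , <-≤-trans i<L L≤L′ , j<f) ∷ chain-weaken L≤L′ ch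

chain-top< : ∀ {L i f Q} → Chain L ((i , f) ∷ Q) → i < L
chain-top< [ _ , i<L ]       = i<L
chain-top< ((_ , i<L , _) ∷ _) = i<L

chain-lower : ∀ {L L′ i f Q} → i < L′ → Chain L ((i , f) ∷ Q) → Chain L′ ((i , f) ∷ Q)
chain-lower i<L′ [ f≤i , _ ]              = [ f≤i , i<L′ ]
chain-lower i<L′ ((f≤i , _ , j<f) ∷ ch)   = (f≤i , i<L′ , j<f) ∷ chain-lower (<-≤-trans j<f (≤-trans f≤i (<⇒≤ i<L′))) ch

chain-tail : ∀ {L i f Q} → Chain L ((i , f) ∷ Q) → Chain f Q
chain-tail [ _ ]                = []
chain-tail ((_ , _ , j<f) ∷ ch) = chain-lower j<f ch

chain-∷ : ∀ {L i f Q} → f ≤ i → i < L → Chain f Q → Chain L ((i , f) ∷ Q)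
chain-∷ f≤i i<L []           = [ f≤i , i<L ]
chain-∷ f≤i i<L ch@([ _ ])   = (f≤i , i<L , chain-top< ch) ∷ chain-weaken (≤-trans f≤i (<⇒≤ i<L)) ch
chain-∷ f≤i i<L ch@(_ ∷ _) = (f≤i , i<L , chain-top< ch) ∷ chain-weaken (≤-trans f≤i (<⇒≤ i<L)) ch

admissible-∷ : ∀ {L β i f Q} → f < i → i < L → Admissible f (β ∸ (i ∸ f)) Q → Admissible L β ((i , f) ∷ Q)
admissible-∷ {β = β} {i} {f} {Q} f<i i<L (admissible ch long e<) =
  admissible (chain-∷ (<⇒≤ f<i) i<L ch) (f<i ∷ long) (<∸⇒+< (i ∸ f) (excess Q) β e<)

admissible-tail : ∀ {L β i f Q} → Admissible L β ((i , f) ∷ Q) → Admissible f (β ∸ (i ∸ f)) Q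
admissible-tail {β = β} {i} {f} {Q} (admissible ch (_ ∷ long) e<) =
  admissible (chain-tail ch) long (+<⇒<∸ (i ∸ f) (excess Q) β e<)

∈headed⁺ : ∀ {i F β f Q} → f < F → Q ∈ chains f (β ∸ (i ∸ f)) → (i , f) ∷ Q ∈ headed i F β
∈headed⁺ {i} {suc F} {β} {f} f<1+F Q∈ with f ≟ F
... | yes refl = ∈-++⁺ʳ (headed i F β) (∈-map⁺ ((i , f) ∷_) Q∈)
... | no f≢F   = ∈-++⁺ˡ (∈headed⁺ (≤∧≢⇒< (≤-pred f<1+F) f≢F) Q∈)

∈headed⁻ : ∀ {i F β Q} → Q ∈ headed i F β → ∃[ f ] ∃[ Q′ ] f < F × Q ≡ (i , f) ∷ Q′ × Q′ ∈ chains f (β ∸ (i ∸ f))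
∈headed⁻ {i} {suc F} {β} Q∈ with ∈-++⁻ (headed i F β) Q∈
... | inj₁ Q∈headed with ∈headed⁻ {i} {F} {β} Q∈headed
...   | f , Q′ , f<F , refl , Q′∈ = f , Q′ , m<n⇒m<1+n f<F , refl , Q′∈
∈headed⁻ {i} {suc F} {β} Q∈ | inj₂ Q∈cons with ∈-map⁻ ((i , F) ∷_) Q∈cons
... | Q′ , Q′∈ , refl = F , Q′ , ≤-refl , refl , Q′∈

∈chains⇒admissible : ∀ {L β Q} → Q ∈ chains L β → Admissible L β Q
∈chains⇒admissible {zero}  {suc β} (here refl) = admissible [] [] z<s
∈chains⇒admissible {suc L} {β}     Q∈ with ∈-++⁻ (chains L β) Q∈
... | inj₁ Q∈chains with ∈chains⇒admissible Q∈chains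
...   | admissible ch long e< = admissible (chain-weaken (n≤1+n L) ch) long e<
∈chains⇒admissible {suc L} {β} Q∈ | inj₂ Q∈headed with ∈headed⁻ {L} {L} {β} Q∈headed
... | f , Q′ , f<L , refl , Q′∈ = admissible-∷ f<L ≤-refl (∈chains⇒admissible Q′∈)

admissible⇒∈chains : ∀ {L β Q} → Admissible L β Q → Q ∈ chains L β
admissible⇒∈chains {L} = go L (<-wellFounded L)
  where
  go : ∀ L → Acc _<_ L → ∀ {β Q} → Admissible L β Q → Q ∈ chains L β
  go zero    _         {suc β} {[]}    _                   = here refl
  go zero    _         {zero}  {[]}    (admissible _ _ ())
  go zero    _         {Q = _ ∷ _}     (admissible ch _ _) = ⊥-elim (n≮0 (chain-top< ch))
  go (suc L) (acc rec) {β}     {[]}    (admissible _ _ e<) = ∈-++⁺ˡ (go L (rec ≤-refl) (admissible [] [] e<))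
  go (suc L) (acc rec) {β} {(i , f) ∷ Q} adm@(admissible ch long@(f<i ∷ _) e<) with i <? L
  ... | yes i<L = ∈-++⁺ˡ (go L (rec ≤-refl) (admissible (chain-lower i<L ch) long e<))
  ... | no i≮L with ≤-antisym (≤-pred (chain-top< ch)) (≮⇒≥ i≮L)
  ...   | refl = ∈-++⁺ʳ (chains L β) (∈headed⁺ f<i (go f (rec (m<n⇒m<1+n f<i)) (admissible-tail adm)))

chains-unique : ∀ L β → Unique (chains L β)
headed-unique : ∀ i F β → Unique (headed i F β)
chains-unique zero    zero    = []
chains-unique zero    (suc β) = [] ∷ []
chains-unique (suc L) β       = Unique.++⁺ (chains-unique L β) (headed-unique L L β) disjoint
  where
  disjoint : ∀ {Q} → Q ∈ chains L β × Q ∈ headed L L β → ⊥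
  disjoint (Q∈chains , Q∈headed) with ∈headed⁻ {L} {L} {β} Q∈headed
  ... | _ , _ , _ , refl , _ = <-irrefl refl (chain-top< (Admissible.chain (∈chains⇒admissible Q∈chains)))
headed-unique i zero    β = []
headed-unique i (suc F) β = Unique.++⁺ (headed-unique i F β) (Unique.map⁺ List.∷-injectiveʳ (chains-unique F (β ∸ (i ∸ F)))) disjoint
  where
  disjoint : ∀ {Q} → Q ∈ headed i F β × Q ∈ map ((i , F) ∷_) (chains F (β ∸ (i ∸ F))) → ⊥
  disjoint (Q∈headed , Q∈cons) with ∈headed⁻ {i} {F} {β} Q∈headed | ∈-map⁻ ((i , F) ∷_) Q∈cons
  ... | f , _ , f<F , refl , _ | _ , _ , refl = <-irrefl refl f<F

sum-lengths : ∀ Q → sum (map lengthSW Q) ≡ excess Q + length Q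
sum-lengths []            = refl
sum-lengths ((i , f) ∷ Q) = trans (cong (suc (i ∸ f) +_) (sum-lengths Q)) (regroup (i ∸ f) (excess Q) (length Q))
  where
  regroup : ∀ a e l → suc a + (e + l) ≡ a + e + suc l
  regroup = solve-∀

length≤excess : ∀ {Q} → All (λ v → proj₂ v < proj₁ v) Q → length Q ≤ excess Q
length≤excess []          = z≤n
length≤excess (f<i ∷ long) = +-mono-≤ (m<n⇒0<n∸m f<i) (length≤excess long)

sum-lengths≤2*excess : ∀ {Q} → All (λ v → proj₂ v < proj₁ v) Q → sum (map lengthSW Q) ≤ 2 * excess Q
sum-lengths≤2*excess {Q} long =
  subst (_≤ 2 * excess Q) (sym (sum-lengths Q)) (+-monoʳ-≤ (excess Q) (subst (length Q ≤_) (sym (+-identityʳ (excess Q))) (length≤excess long)))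

long⇒lengths≥2 : ∀ {Q} → All (λ v → proj₂ v < proj₁ v) Q → All (2 ≤_) (map lengthSW Q)
long⇒lengths≥2 []           = []
long⇒lengths≥2 (f<i ∷ long) = s≤s (m<n⇒0<n∸m f<i) ∷ long⇒lengths≥2 long

lengths≥2⇒long : ∀ Q → All (2 ≤_) (map lengthSW Q) → All (λ v → proj₂ v < proj₁ v) Q
lengths≥2⇒long []            []             = []
lengths≥2⇒long ((i , f) ∷ Q) (s≤s 1≤i∸f ∷ ls) = m∸n≢0⇒n<m (λ i∸f≡0 → <-irrefl (sym i∸f≡0) 1≤i∸f) ∷ lengths≥2⇒long Q ls

module Kummer {p : ℕ} (p-prime : Prime p) where

  instance
    p≢0 : NonZero p
    p≢0 = prime⇒nonZero p-prime

  1<p : 1 < p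
  1<p = nonTrivial⇒n>1 p {{prime⇒nonTrivial p-prime}}

  record ExactPower (e x : ℕ) : Set where
    constructor exactPower
    field
      cofactor   : ℕ
      factorises : x ≡ p ^ e * cofactor
      p∤cofactor : p ∤ cofactor

  p∤1 : p ∤ 1
  p∤1 = >⇒∤ 1<p

  exactPower-* : ∀ {a b x y} → ExactPower a x → ExactPower b y → ExactPower (a + b) (x * y)
  exactPower-* {a} {b} (exactPower u refl p∤u) (exactPower v refl p∤v) =
    exactPower (u * v) rearranged (λ p∣uv → [ p∤u , p∤v ]′ (euclidsLemma u v p-prime p∣uv))
    where
    rearranged : p ^ a * u * (p ^ b * v) ≡ p ^ (a + b) * (u * v)
    rearranged = begin
      p ^ a * u * (p ^ b * v)   ≡⟨ interchange (p ^ a) u (p ^ b) v ⟩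
      p ^ a * p ^ b * (u * v)   ≡⟨ cong (_* (u * v)) (^-distribˡ-+-* p a b) ⟨
      p ^ (a + b) * (u * v)     ∎
      where open ≡-Reasoning

  p^α∣p^β : ∀ {α β} → α ≤ β → p ^ α ∣ p ^ β
  p^α∣p^β {α} {β} α≤β = divides (p ^ (β ∸ α)) (begin
    p ^ β               ≡⟨ cong (p ^_) (m∸n+n≡m α≤β) ⟨
    p ^ (β ∸ α + α)     ≡⟨ ^-distribˡ-+-* p (β ∸ α) α ⟩
    p ^ (β ∸ α) * p ^ α ∎)
    where open ≡-Reasoning

  exactPower-∣⇔ : ∀ {e x} → ExactPower e x → ∀ α → p ^ α ∣ x ⇔ α ≤ e
  exactPower-∣⇔ {e} (exactPower u refl p∤u) α = mk⇔ to from
    where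
    to : p ^ α ∣ p ^ e * u → α ≤ e
    to p^α∣x with α ≤? e
    ... | yes α≤e = α≤e
    ... | no α≰e = ⊥-elim (p∤u (*-cancelˡ-∣ (p ^ e) {{m^n≢0 p e}} p^e*p∣p^e*u))
      where
      p^e*p∣p^e*u : p ^ e * p ∣ p ^ e * u
      p^e*p∣p^e*u = ∣-trans (subst (_∣ p ^ α) (*-comm p (p ^ e)) (p^α∣p^β (≰⇒> α≰e))) p^α∣x
    from : α ≤ e → p ^ α ∣ p ^ e * u
    from α≤e = ∣-trans (p^α∣p^β α≤e) (m∣m*n u)

  exactPower-unique : ∀ {a b x} → ExactPower a x → ExactPower b x → a ≡ b
  exactPower-unique pa pb = ≤-antisym
    (Equivalence.to (exactPower-∣⇔ pb _) (Equivalence.from (exactPower-∣⇔ pa _) ≤-refl))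
    (Equivalence.to (exactPower-∣⇔ pa _) (Equivalence.from (exactPower-∣⇔ pb _) ≤-refl))

  exactPower-exists : ∀ x → 0 < x → ∃[ e ] ExactPower e x
  exactPower-exists x = go x (<-wellFounded x)
    where
    go : ∀ x → Acc _<_ x → 0 < x → ∃[ e ] ExactPower e x
    go x _ _ with p ∣? x
    go x _ _ | no p∤x = 0 , exactPower x (sym (*-identityˡ x)) p∤x
    go _ _ () | yes (divides zero refl)
    go _ (acc rec) _ | yes (divides q@(suc _) refl) with go q (rec (m<m*n q p 1<p)) z<s
    ... | e , exactPower u q≡p^e*u p∤u = suc e , exactPower u factorises p∤u
      where
      factorises : q * p ≡ p * p ^ e * u
      factorises = trans (cong (_* p) q≡p^e*u) (xy∙z≈zx∙y (p ^ e) u p)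

  exactPower-cancel : ∀ {a b x y} → ExactPower a x → ExactPower b (y * x) → 0 < y →
                      a ≤ b × ExactPower (b ∸ a) y
  exactPower-cancel {a} {b} pa pb 0<y with exactPower-exists _ 0<y
  ... | c , pc = a≤b , subst (λ e → ExactPower e _) c≡b∸a pc
    where
    c+a≡b : c + a ≡ b
    c+a≡b = exactPower-unique (exactPower-* pc pa) pb
    a≤b : a ≤ b
    a≤b = subst (a ≤_) (trans (+-comm a c) c+a≡b) (m≤m+n a c)
    c≡b∸a : c ≡ b ∸ a
    c≡b∸a = trans (sym (m+n∸n≡m c a)) (cong (_∸ a) c+a≡b)

  -- legendre′ f n = ⌊n/p⌋ + ⌊n/p²⌋ + ⋯, truncated after f terms; f = n terms suffice.
  legendre′ : ℕ → ℕ → ℕ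
  legendre′ zero       n = 0
  legendre′ (suc fuel) n = n / p + legendre′ fuel (n / p)

  legendre : ℕ → ℕ
  legendre n = legendre′ n n

  n/p<n : ∀ n → suc n / p < suc n
  n/p<n n = m/n<m (suc n) p 1<p

  legendre′-fuel : ∀ {f g} n → n ≤ f → n ≤ g → legendre′ f n ≡ legendre′ g n
  legendre′-fuel {f} {g} zero _ _ = trans (vanishes f) (sym (vanishes g))
    where
    vanishes : ∀ f → legendre′ f 0 ≡ 0
    vanishes zero    = refl
    vanishes (suc f) = trans (cong (λ q → q + legendre′ f q) (0/n≡0 p)) (vanishes f)
  legendre′-fuel {suc f} {suc g} (suc n) (s≤s n≤f) (s≤s n≤g) =
    cong (suc n / p +_) (legendre′-fuel (suc n / p) (≤-trans (≤-pred (n/p<n n)) n≤f) (≤-trans (≤-pred (n/p<n n)) n≤g))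

  legendre-unfold : ∀ n → legendre n ≡ n / p + legendre (n / p)
  legendre-unfold zero    = sym (cong (λ q → q + legendre q) (0/n≡0 p))
  legendre-unfold (suc n) = cong (suc n / p +_) (legendre′-fuel (suc n / p) (≤-pred (n/p<n n)) ≤-refl)

  [r+N*p]/p≡N : ∀ {r} N → r < p → (r + N * p) / p ≡ N
  [r+N*p]/p≡N {r} N r<p = begin
    (r + N * p) / p     ≡⟨ +-distrib-/-∣ʳ r (n∣m*n N) ⟩
    r / p + N * p / p   ≡⟨ cong₂ _+_ (m<n⇒m/n≡0 r<p) (m*n/n≡m N p) ⟩
    N                   ∎
    where open ≡-Reasoning

  legendre-digit : ∀ {r} N → r < p → legendre (r + N * p) ≡ N + legendre N
  legendre-digit {r} N r<p = begin
    legendre (r + N * p)                                   ≡⟨ legendre-unfold (r + N * p) ⟩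
    (r + N * p) / p + legendre ((r + N * p) / p)           ≡⟨ cong (λ q → q + legendre q) ([r+N*p]/p≡N N r<p) ⟩
    N + legendre N                                         ∎
    where open ≡-Reasoning

  exactPower-p : ExactPower 1 p
  exactPower-p = exactPower 1 (sym (trans (*-identityʳ (p * 1)) (*-identityʳ p))) p∤1

  legendre-suc-unit : ∀ {r} N → suc r < p → legendre (suc r + N * p) ≡ legendre (r + N * p)
  legendre-suc-unit N r<p = trans (legendre-digit N r<p) (sym (legendre-digit N (<-trans (n<1+n _) r<p)))

  p∤[1+r+N*p] : ∀ {r} N → suc r < p → p ∤ suc r + N * p
  p∤[1+r+N*p] {r} N r<p p∣ = >⇒∤ r<p (∣m+n∣m⇒∣n (subst (p ∣_) (+-comm (suc r) (N * p)) p∣) (n∣m*n N))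

  legendre-suc : ∀ k → legendre k ≤ legendre (suc k) × ExactPower (legendre (suc k) ∸ legendre k) (suc k)
  legendre-suc k = go k (<-wellFounded k)
    where
    go : ∀ k → Acc _<_ k → legendre k ≤ legendre (suc k) × ExactPower (legendre (suc k) ∸ legendre k) (suc k)
    go k (acc rec) = split (suc k % p) (suc k / p) (m%n<n (suc k) p) (m≡m%n+[m/n]*n (suc k) p)
      where
      split : ∀ r N → r < p → suc k ≡ r + N * p →
              legendre k ≤ legendre (suc k) × ExactPower (legendre (suc k) ∸ legendre k) (suc k)
      split zero zero _ ()
      split (suc r) N r<p refl = ≤-reflexive (sym (legendre-suc-unit N r<p)) ,
        subst (λ e → ExactPower e (suc r + N * p)) (sym (trans (cong (_∸ legendre (r + N * p)) (legendre-suc-unit N r<p)) (n∸n≡0 (legendre (r + N * p)))))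
              (exactPower (suc r + N * p) (sym (*-identityˡ (suc r + N * p))) (p∤[1+r+N*p] N r<p))
      split zero (suc N) _ sk≡ = increases , subst (λ e → ExactPower e (suc k)) (sym exponent) (subst (ExactPower _) (sym sk≡) power)
        where
        k≡ : k ≡ pred p + N * p
        k≡ = suc-injective (trans sk≡ (cong (_+ N * p) (sym (suc-pred p))))
        ih : legendre N ≤ legendre (suc N) × ExactPower (legendre (suc N) ∸ legendre N) (suc N)
        ih = go N (rec (subst (N <_) (sym k≡) (<-≤-trans (n<1+n N) (+-mono-≤ (pred-mono-≤ 1<p) (m≤m*n N p)))))
        leg-k : legendre k ≡ N + legendre N
        leg-k = trans (cong legendre k≡) (legendre-digit N (subst (pred p <_) (suc-pred p) (n<1+n (pred p))))
        leg-sk : legendre (suc k) ≡ suc N + legendre (suc N)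
        leg-sk = trans (cong legendre sk≡) (legendre-digit (suc N) (>-nonZero⁻¹ p))
        increases : legendre k ≤ legendre (suc k)
        increases = subst₂ _≤_ (sym leg-k) (sym leg-sk) (+-mono-≤ (n≤1+n N) (proj₁ ih))
        exponent : legendre (suc k) ∸ legendre k ≡ suc (legendre (suc N) ∸ legendre N)
        exponent = trans (cong₂ _∸_ leg-sk leg-k) ([1+m+n]∸[m+o]≡1+[n∸o] N (proj₁ ih))
        power : ExactPower (suc (legendre (suc N) ∸ legendre N)) (suc N * p)
        power = subst (λ e → ExactPower e (suc N * p)) (+-comm _ 1) (exactPower-* (proj₂ ih) exactPower-p)

  legendre-exactPower : ∀ n → ExactPower (legendre n) (n !)
  legendre-exactPower zero    = exactPower 1 refl p∤1
  legendre-exactPower (suc n) = subst (λ e → ExactPower e (suc n !)) (m∸n+n≡m (proj₁ (legendre-suc n)))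
    (exactPower-* (proj₂ (legendre-suc n)) (legendre-exactPower n))

  binomial*factorials : ∀ m k → ((m + k) C m) * (m ! * k !) ≡ (m + k) !
  binomial*factorials m k = subst (λ j → ((m + k) C m) * (m ! * j !) ≡ (m + k) !) (m+n∸m≡n m k) exact
    where
    instance _ = m !* (m + k ∸ m) !≢0
    exact : ((m + k) C m) * (m ! * (m + k ∸ m) !) ≡ (m + k) !
    exact = trans (cong (_* (m ! * (m + k ∸ m) !)) (nCk≡n!/k![n-k]! (m≤m+n m k))) (m/n*n≡m (k![n∸k]!∣n! (m≤m+n m k)))

  binomial-exactPower : ∀ m k → legendre m + legendre k ≤ legendre (m + k) ×
                        ExactPower (legendre (m + k) ∸ (legendre m + legendre k)) ((m + k) C m)
  binomial-exactPower m k = exactPower-cancel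
    (exactPower-* (legendre-exactPower m) (legendre-exactPower k))
    (subst (ExactPower _) (sym (binomial*factorials m k)) (legendre-exactPower (m + k)))
    positive
    where
    positive : 0 < (m + k) C m
    positive with (m + k) C m | binomial*factorials m k
    ... | suc _ | _  = z<s
    ... | zero  | eq = ⊥-elim (<-irrefl refl (subst (1 ≤_) (sym eq) (1≤n! (m + k))))

  -- By Legendre's formula, the number of carries when adding m and k in base p with initial carry c.
  carries : Bool → ℕ → ℕ → ℕ
  carries c m k = legendre (toℕ c + m + k) ∸ (legendre m + legendre k)

  kummer : ∀ m k α → p ^ α ∣ (m + k) C m ⇔ α ≤ carries false m k
  kummer m k = exactPower-∣⇔ (proj₂ (binomial-exactPower m k))

  legendre-superadditive : ∀ m k → legendre m + legendre k ≤ legendre (suc (m + k))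
  legendre-superadditive m k = ≤-trans (proj₁ (binomial-exactPower m k)) (proj₁ (legendre-suc (m + k)))

  private
    cancel-digits : ∀ M K x y z → M + K + x ∸ (M + y + (K + z)) ≡ x ∸ (y + z)
    cancel-digits M K x y z = begin
      M + K + x ∸ (M + y + (K + z))   ≡⟨ cong (M + K + x ∸_) (regroup M K y z) ⟩
      M + K + x ∸ (M + K + (y + z))   ≡⟨ [m+n]∸[m+o]≡n∸o (M + K) x (y + z) ⟩
      x ∸ (y + z)                     ∎
      where
      open ≡-Reasoning
      regroup : ∀ M K y z → M + y + (K + z) ≡ M + K + (y + z)
      regroup = solve-∀

  digitwise-+ : ∀ c r t M K → c + (r + M * p) + (t + K * p) ≡ (c + r + t) + (M + K) * p
  digitwise-+ c r t M K = regroup c r t M K p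
    where
    regroup : ∀ c r t M K p → c + (r + M * p) + (t + K * p) ≡ (c + r + t) + (M + K) * p
    regroup = solve-∀

  carries-noCarry : ∀ c {r t n₀} M K → r < p → t < p → toℕ c + r + t ≡ n₀ → n₀ < p →
                    carries c (r + M * p) (t + K * p) ≡ carries false M K
  carries-noCarry c {r} {t} M K r<p t<p refl n₀<p = begin
    legendre (toℕ c + (r + M * p) + (t + K * p)) ∸ (legendre (r + M * p) + legendre (t + K * p))
      ≡⟨ cong₂ _∸_ (trans (cong legendre (digitwise-+ (toℕ c) r t M K)) (legendre-digit (M + K) n₀<p))
                   (cong₂ _+_ (legendre-digit M r<p) (legendre-digit K t<p)) ⟩
    M + K + legendre (M + K) ∸ (M + legendre M + (K + legendre K))
      ≡⟨ cancel-digits M K _ _ _ ⟩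
    carries false M K ∎
    where open ≡-Reasoning

  carries-carry : ∀ c {r t n₀} M K → r < p → t < p → toℕ c + r + t ≡ n₀ + p → n₀ < p →
                  carries c (r + M * p) (t + K * p) ≡ suc (carries true M K)
  carries-carry c {r} {t} {n₀} M K r<p t<p sum≡ n₀<p = begin
    legendre (toℕ c + (r + M * p) + (t + K * p)) ∸ (legendre (r + M * p) + legendre (t + K * p))
      ≡⟨ cong₂ _∸_ (trans (cong legendre total) (legendre-digit (suc (M + K)) n₀<p))
                   (cong₂ _+_ (legendre-digit M r<p) (legendre-digit K t<p)) ⟩
    suc (M + K) + legendre (suc (M + K)) ∸ (M + legendre M + (K + legendre K))
      ≡⟨ cong (_∸ (M + legendre M + (K + legendre K))) (+-suc (M + K) _) ⟨
    M + K + suc (legendre (suc (M + K))) ∸ (M + legendre M + (K + legendre K))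
      ≡⟨ cancel-digits M K _ _ _ ⟩
    suc (legendre (suc (M + K))) ∸ (legendre M + legendre K)
      ≡⟨ +-∸-assoc 1 (legendre-superadditive M K) ⟩
    suc (carries true M K) ∎
    where
    open ≡-Reasoning
    total : toℕ c + (r + M * p) + (t + K * p) ≡ n₀ + suc (M + K) * p
    total = trans (digitwise-+ (toℕ c) r t M K) (trans (cong (_+ (M + K) * p) sum≡) (regroup n₀ p (M + K)))
      where
      regroup : ∀ n p S → n + p + S * p ≡ n + (suc S) * p
      regroup = solve-∀

module Counting {p : ℕ} (p-prime : Prime p) where
  open Kummer p-prime

  count : Bool → ℕ → ℕ → ℕ
  count c n α = ∑[ m < suc n ∸ toℕ c ] 𝟙 (carries c m (n ∸ toℕ c ∸ m) <? α)

  a≡count : ∀ α n → a p α n ≡ count false n α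
  a≡count α n = trans (length-filter-applyUpTo _ id (suc n)) (∑<-cong (suc n) pointwise)
    where
    pointwise : ∀ {m} → m < suc n → 𝟙 (¬? (p ^ α ∣? n C m)) ≡ 𝟙 (carries false m (n ∸ m) <? α)
    pointwise {m} m<sn = 𝟙-cong (mk⇔ (λ p^α∤ → ≰⇒> (p^α∤ ∘ Equivalence.from kummer′)) (λ lt → <⇒≱ lt ∘ Equivalence.to kummer′))
      (¬? (p ^ α ∣? n C m)) (carries false m (n ∸ m) <? α)
      where
      kummer′ : p ^ α ∣ n C m ⇔ α ≤ carries false m (n ∸ m)
      kummer′ = subst (λ j → p ^ α ∣ j C m ⇔ α ≤ carries false m (n ∸ m)) (m+[n∸m]≡n (≤-pred m<sn)) (kummer m (n ∸ m) α)

  -- the number of digits r < p with toℕ cin + r ≤ d (no carry out), resp. > d (carry out)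
  digitWeight : Bool → Bool → ℕ → ℕ
  digitWeight cin false d = suc d ∸ toℕ cin
  digitWeight cin true  d = p ∸ (suc d ∸ toℕ cin)

  module _ (c : Bool) {n₀ : ℕ} (N α : ℕ) (n₀<p : n₀ < p) where
    private
      n c′ w w′ : ℕ
      n = n₀ + N * p
      c′ = toℕ c
      w = digitWeight c false n₀
      w′ = digitWeight c true n₀

      summand stay carry : ℕ → ℕ
      summand m = 𝟙 (carries c m (n ∸ c′ ∸ m) <? α)
      stay M = 𝟙 (carries false M (N ∸ M) <? α)
      carry M = 𝟙 (carries true M (N ∸ 1 ∸ M) <? α ∸ 1)

      c′≤1+n₀ : c′ ≤ suc n₀
      c′≤1+n₀ = ≤-trans (toℕ≤1 c) (s≤s z≤n)

      w≤p : w ≤ p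
      w≤p = ≤-trans (m∸n≤m (suc n₀) c′) n₀<p

      summand-stay : ∀ {r M} → r < w → M ≤ N → summand (r + M * p) ≡ stay M
      summand-stay {r} {M} r<w M≤N = cong (λ x → 𝟙 (x <? α))
        (trans (cong (carries c (r + M * p)) (m+n+o≡q⇒q∸m∸n≡o {c′} {r + M * p} total)) (carries-noCarry c M (N ∸ M) r<p t<p c′+r+t≡n₀ n₀<p))
        where
        t : ℕ
        t = n₀ ∸ (c′ + r)
        c′+r≤n₀ : c′ + r ≤ n₀
        c′+r≤n₀ = ≤-pred (subst (c′ + r <_) (m+[n∸m]≡n c′≤1+n₀) (+-monoʳ-< c′ r<w))
        c′+r+t≡n₀ : c′ + r + t ≡ n₀
        c′+r+t≡n₀ = m+[n∸m]≡n c′+r≤n₀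
        r<p : r < p
        r<p = ≤-<-trans (≤-trans (m≤n+m r c′) c′+r≤n₀) n₀<p
        t<p : t < p
        t<p = ≤-<-trans (m∸n≤m n₀ (c′ + r)) n₀<p
        total : c′ + (r + M * p) + (t + (N ∸ M) * p) ≡ n
        total = trans (digitwise-+ c′ r t M (N ∸ M)) (cong₂ (λ x y → x + y * p) c′+r+t≡n₀ (m+[n∸m]≡n M≤N))

      summand-carry : ∀ {r M} → w ≤ r → r < p → M < N → summand (r + M * p) ≡ carry M
      summand-carry {r} {M} w≤r r<p M<N = trans (cong (λ x → 𝟙 (x <? α))
        (trans (cong (carries c (r + M * p)) (m+n+o≡q⇒q∸m∸n≡o {c′} {r + M * p} total)) (carries-carry c M K r<p t<p c′+r+t≡n₀+p n₀<p)))
        (𝟙-suc< (carries true M K) α)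
        where
        K : ℕ
        K = N ∸ 1 ∸ M
        t : ℕ
        t = n₀ + p ∸ (c′ + r)
        n₀<c′+r : n₀ < c′ + r
        n₀<c′+r = subst (_≤ c′ + r) (m+[n∸m]≡n c′≤1+n₀) (+-monoʳ-≤ c′ w≤r)
        c′+r+t≡n₀+p : c′ + r + t ≡ n₀ + p
        c′+r+t≡n₀+p = m+[n∸m]≡n (≤-trans (+-monoˡ-≤ r (toℕ≤1 c)) (≤-trans r<p (m≤n+m p n₀)))
        t<p : t < p
        t<p = m<n+o⇒m∸n<o (n₀ + p) (c′ + r) (+-monoˡ-< p n₀<c′+r)
        1+M+K≡N : suc (M + K) ≡ N
        1+M+K≡N = trans (cong (suc M +_) (∸-+-assoc N 1 M)) (m+[n∸m]≡n M<N)
        total : c′ + (r + M * p) + (t + K * p) ≡ n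
        total = trans (digitwise-+ c′ r t M K) (trans (cong (_+ (M + K) * p) c′+r+t≡n₀+p)
                  (trans (shift n₀ p (M + K)) (cong (λ x → n₀ + x * p) 1+M+K≡N)))
          where
          shift : ∀ n p S → n + p + S * p ≡ n + suc S * p
          shift = solve-∀

      top-block : ∑[ r < w ] summand (N * p + r) ≡ w * stay N
      top-block = trans (∑<-cong w (λ {r} r<w → trans (cong summand (+-comm (N * p) r)) (summand-stay r<w ≤-refl))) (∑<-const w (stay N))

      full-block : ∀ {M} → M < N → ∑[ r < p ] summand (r + M * p) ≡ w * stay M + w′ * carry M
      full-block {M} M<N = begin
        ∑[ r < p ] summand (r + M * p)                                            ≡⟨ cong (λ s → ∑[ r < s ] summand (r + M * p)) (m+[n∸m]≡n w≤p) ⟨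
        ∑[ r < w + (p ∸ w) ] summand (r + M * p)                                  ≡⟨ ∑<-+ (λ r → summand (r + M * p)) w (p ∸ w) ⟩
        ∑[ r < w ] summand (r + M * p) + ∑[ j < p ∸ w ] summand (w + j + M * p)   ≡⟨ cong₂ _+_
             (trans (∑<-cong w (λ r<w → summand-stay r<w (<⇒≤ M<N))) (∑<-const w (stay M)))
             (trans (∑<-cong (p ∸ w) (λ {j} j<p∸w → summand-carry (m≤m+n w j) (w+j<p j<p∸w) M<N)) (∑<-const (p ∸ w) (carry M))) ⟩
        w * stay M + w′ * carry M                                                 ∎
        where
        open ≡-Reasoning
        w+j<p : ∀ {j} → j < p ∸ w → w + j < p
        w+j<p j<p∸w = subst (_ <_) (m+[n∸m]≡n w≤p) (+-monoʳ-< w j<p∸w)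

    -- Writing m = r + M * p, the lowest digit produces a carry exactly when toℕ c + r > n₀.
    count-digit : count c (n₀ + N * p) α ≡
                  digitWeight c false n₀ * count false N α + digitWeight c true n₀ * count true N (α ∸ 1)
    count-digit = begin
      ∑< (suc n ∸ c′) summand                                    ≡⟨ cong (λ s → ∑< s summand) size ⟩
      ∑< (N * p + w) summand                                     ≡⟨ ∑<-+ summand (N * p) w ⟩
      ∑< (N * p) summand + ∑[ r < w ] summand (N * p + r)        ≡⟨ cong₂ _+_ (∑<-blocks summand N p) top-block ⟩
      ∑[ M < N ] ∑[ r < p ] summand (r + M * p) + w * stay N     ≡⟨ cong (_+ w * stay N) (∑<-cong N full-block) ⟩
      ∑[ M < N ] (w * stay M + w′ * carry M) + w * stay N        ≡⟨ cong (_+ w * stay N) (trans (∑<-distrib-+ _ _ N)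
                                                                      (cong₂ _+_ (∑<-distribˡ-* w stay N) (∑<-distribˡ-* w′ carry N))) ⟩
      w * ∑< N stay + w′ * ∑< N carry + w * stay N               ≡⟨ regroup w (∑< N stay) w′ (∑< N carry) (stay N) ⟩
      w * count false N α + w′ * count true N (α ∸ 1)            ∎
      where
      open ≡-Reasoning
      size : suc n ∸ c′ ≡ N * p + w
      size = trans (+-∸-comm (N * p) c′≤1+n₀) (+-comm w (N * p))
      regroup : ∀ w A w′ B x → w * A + w′ * B + w * x ≡ w * (A + x) + w′ * B
      regroup = solve-∀

  -- carryPaths cin cout ds β counts the digit strings of m, read from the least significant
  -- digit ds, entering with carry cin and leaving with carry cout, with fewer than β carries.
  carryPaths : Bool → Bool → List ℕ → ℕ → ℕ
  carryPaths cin cout (d ∷ ds) β =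
    digitWeight cin false d * carryPaths false cout ds β + digitWeight cin true d * carryPaths true cout ds (β ∸ 1)
  carryPaths false false [] β = 𝟙 (0 <? β)
  carryPaths true  true  [] β = 𝟙 (0 <? β)
  carryPaths _     _     [] β = 0

  count≡carryPaths : ∀ c n α → count c n α ≡ carryPaths c false (digits p n) α
  count≡carryPaths c n = go c n (<-wellFounded n)
    where
    go : ∀ c n → Acc _<_ n → ∀ α → count c n α ≡ carryPaths c false (digits p n) α
    go false zero _ α rewrite digits-zero p = refl
    go true  zero _ α rewrite digits-zero p = refl
    go c (suc n) (acc rec) α = begin
      count c (suc n) α
        ≡⟨ cong (λ m → count c m α) (m≡m%n+[m/n]*n (suc n) p) ⟩
      count c (n₀ + N * p) α
        ≡⟨ count-digit c N α (m%n<n (suc n) p) ⟩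
      digitWeight c false n₀ * count false N α + digitWeight c true n₀ * count true N (α ∸ 1)
        ≡⟨ cong₂ (λ x y → digitWeight c false n₀ * x + digitWeight c true n₀ * y) (go false N (rec N<n) α) (go true N (rec N<n) (α ∸ 1)) ⟩
      carryPaths c false (n₀ ∷ digits p N) α
        ≡⟨ cong (λ ds → carryPaths c false ds α) (digits-suc p 1<p n) ⟨
      carryPaths c false (digits p (suc n)) α ∎
      where
      open ≡-Reasoning
      n₀ : ℕ
      n₀ = suc n % p
      N : ℕ
      N = suc n / p
      N<n : N < suc n
      N<n = m/n<m (suc n) p 1<p

  private
    +0ʳ : ∀ a x b → a * x + b * 0 ≡ a * x
    +0ʳ a x b = trans (cong (a * x +_) (*-zeroʳ b)) (+-identityʳ (a * x))
    +0ˡ : ∀ a x b → b * 0 + a * x ≡ a * x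
    +0ˡ a x b = cong (_+ a * x) (*-zeroʳ b)

  carryPaths-∷ʳ : ∀ ds d cin cout β →
    carryPaths cin cout (ds ++ d ∷ []) β ≡
      digitWeight false cout d * carryPaths cin false ds (β ∸ toℕ cout) + digitWeight true cout d * carryPaths cin true ds (β ∸ toℕ cout)
  carryPaths-∷ʳ [] d false false β = trans (+0ʳ (W false false) (𝟙 (0 <? β)) (W false true)) (sym (+0ʳ (W false false) (𝟙 (0 <? β)) (W true false)))
    where W = λ cin cout → digitWeight cin cout d
  carryPaths-∷ʳ [] d true  true  β = trans (+0ˡ (W true true) (𝟙 (0 <? β ∸ 1)) (W true false)) (sym (+0ˡ (W true true) (𝟙 (0 <? β ∸ 1)) (W false true)))
    where W = λ cin cout → digitWeight cin cout d
  carryPaths-∷ʳ [] d false true  β = trans (+0ˡ (W false true) (𝟙 (0 <? β ∸ 1)) (W false false)) (sym (+0ʳ (W false true) (𝟙 (0 <? β ∸ 1)) (W true true)))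
    where W = λ cin cout → digitWeight cin cout d
  carryPaths-∷ʳ [] d true  false β = trans (+0ʳ (W true false) (𝟙 (0 <? β)) (W true true)) (sym (+0ˡ (W true false) (𝟙 (0 <? β)) (W false false)))
    where W = λ cin cout → digitWeight cin cout d
  carryPaths-∷ʳ (e ∷ ds) d cin cout β = begin
    a₀ * carryPaths false cout (ds ++ d ∷ []) β + a₁ * carryPaths true cout (ds ++ d ∷ []) (β ∸ 1)
      ≡⟨ cong₂ (λ x y → a₀ * x + a₁ * y) (carryPaths-∷ʳ ds d false cout β) (carryPaths-∷ʳ ds d true cout (β ∸ 1)) ⟩
    a₀ * (b₀ * P₀₀ (β ∸ δ) + b₁ * P₀₁ (β ∸ δ)) + a₁ * (b₀ * P₁₀ (β ∸ 1 ∸ δ) + b₁ * P₁₁ (β ∸ 1 ∸ δ))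
      ≡⟨ cong (λ γ → a₀ * (b₀ * P₀₀ (β ∸ δ) + b₁ * P₀₁ (β ∸ δ)) + a₁ * (b₀ * P₁₀ γ + b₁ * P₁₁ γ)) (∸-∸-comm β δ) ⟩
    a₀ * (b₀ * P₀₀ (β ∸ δ) + b₁ * P₀₁ (β ∸ δ)) + a₁ * (b₀ * P₁₀ (β ∸ δ ∸ 1) + b₁ * P₁₁ (β ∸ δ ∸ 1))
      ≡⟨ swap-sums a₀ a₁ b₀ b₁ _ _ _ _ ⟩
    b₀ * (a₀ * P₀₀ (β ∸ δ) + a₁ * P₁₀ (β ∸ δ ∸ 1)) + b₁ * (a₀ * P₀₁ (β ∸ δ) + a₁ * P₁₁ (β ∸ δ ∸ 1)) ∎
    where
    open ≡-Reasoning
    P₀₀ P₀₁ P₁₀ P₁₁ : ℕ → ℕ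
    P₀₀ = carryPaths false false ds
    P₀₁ = carryPaths false true ds
    P₁₀ = carryPaths true false ds
    P₁₁ = carryPaths true true ds
    δ : ℕ
    δ = toℕ cout
    a₀ : ℕ
    a₀ = digitWeight cin false e
    a₁ : ℕ
    a₁ = digitWeight cin true e
    b₀ : ℕ
    b₀ = digitWeight false cout d
    b₁ : ℕ
    b₁ = digitWeight true cout d
    swap-sums : ∀ a₀ a₁ b₀ b₁ x₀ x₁ y₀ y₁ →
      a₀ * (b₀ * x₀ + b₁ * x₁) + a₁ * (b₀ * y₀ + b₁ * y₁) ≡ b₀ * (a₀ * x₀ + a₁ * y₀) + b₁ * (a₀ * x₁ + a₁ * y₁)
    swap-sums = solve-∀

module DigitWindows {p : ℕ} (p-prime : Prime p) (ds : List ℕ) where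
  open Counting p-prime

  digit : ℕ → ℕ
  digit = digitAt ds

  prefixPaths : Bool → ℕ → ℕ → ℕ
  prefixPaths cout L β = carryPaths false cout (take L ds) β

  prefixPaths-suc : ∀ cout L β → L < length ds →
    prefixPaths cout (suc L) β ≡
      digitWeight false cout (digit L) * prefixPaths false L (β ∸ toℕ cout) + digitWeight true cout (digit L) * prefixPaths true L (β ∸ toℕ cout)
  prefixPaths-suc cout L β L<n =
    trans (cong (λ xs → carryPaths false cout xs β) (take-suc ds L L<n)) (carryPaths-∷ʳ (take L ds) (digit L) false cout β)

  -- the weight of a run of carries started at position f and propagated through f + 1, …, f + k
  runWeight : ℕ → ℕ → ℕ
  runWeight f zero    = digitWeight false true (digit f)
  runWeight f (suc k) = digitWeight true true (digit (f + suc k)) * runWeight f k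

  prefixPaths-true : ∀ L → L ≤ length ds → ∀ β →
    prefixPaths true L β ≡ ∑[ f < L ] (runWeight f (L ∸ suc f) * prefixPaths false f (β ∸ (L ∸ f)))
  prefixPaths-true zero    _     β = refl
  prefixPaths-true (suc L) L<n β = begin
    prefixPaths true (suc L) β
      ≡⟨ prefixPaths-suc true L β L<n ⟩
    w₀ * A L (β ∸ 1) + w₁ * prefixPaths true L (β ∸ 1)
      ≡⟨ cong (λ x → w₀ * A L (β ∸ 1) + w₁ * x) (prefixPaths-true L (<⇒≤ L<n) (β ∸ 1)) ⟩
    w₀ * A L (β ∸ 1) + w₁ * ∑[ f < L ] (runWeight f (L ∸ suc f) * A f (β ∸ 1 ∸ (L ∸ f)))
      ≡⟨ cong (w₀ * A L (β ∸ 1) +_) (∑<-distribˡ-* w₁ _ L) ⟨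
    w₀ * A L (β ∸ 1) + ∑[ f < L ] (w₁ * (runWeight f (L ∸ suc f) * A f (β ∸ 1 ∸ (L ∸ f))))
      ≡⟨ +-comm (w₀ * A L (β ∸ 1)) _ ⟩
    ∑[ f < L ] (w₁ * (runWeight f (L ∸ suc f) * A f (β ∸ 1 ∸ (L ∸ f)))) + w₀ * A L (β ∸ 1)
      ≡⟨ cong₂ _+_ (∑<-cong L extend) last ⟩
    ∑[ f < suc L ] (runWeight f (suc L ∸ suc f) * A f (β ∸ (suc L ∸ f))) ∎
    where
    open ≡-Reasoning
    A : ℕ → ℕ → ℕ
    A = prefixPaths false
    w₀ : ℕ
    w₀ = digitWeight false true (digit L)
    w₁ : ℕ
    w₁ = digitWeight true true (digit L)
    last : w₀ * A L (β ∸ 1) ≡ runWeight L (L ∸ L) * A L (β ∸ (suc L ∸ L))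
    last = cong₂ (λ k j → runWeight L k * A L (β ∸ j)) (sym (n∸n≡0 L)) (sym (trans (+-∸-assoc 1 {L} ≤-refl) (cong suc (n∸n≡0 L))))
    extend : ∀ {f} → f < L → w₁ * (runWeight f (L ∸ suc f) * A f (β ∸ 1 ∸ (L ∸ f))) ≡ runWeight f (L ∸ f) * A f (β ∸ (suc L ∸ f))
    extend {f} f<L = begin
      w₁ * (runWeight f (L ∸ suc f) * A f (β ∸ 1 ∸ (L ∸ f)))     ≡⟨ *-assoc w₁ _ _ ⟨
      w₁ * runWeight f (L ∸ suc f) * A f (β ∸ 1 ∸ (L ∸ f))
        ≡⟨ cong₂ (λ i γ → digitWeight true true (digit i) * runWeight f (L ∸ suc f) * A f γ) (sym f+[L∸f]≡L) β∸1∸[L∸f] ⟩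
      runWeight f (suc (L ∸ suc f)) * A f (β ∸ (suc L ∸ f))      ≡⟨ cong (λ k → runWeight f k * A f (β ∸ (suc L ∸ f))) (sym L∸f≡) ⟩
      runWeight f (L ∸ f) * A f (β ∸ (suc L ∸ f))                ∎
      where
      L∸f≡ : L ∸ f ≡ suc (L ∸ suc f)
      L∸f≡ = +-∸-assoc 1 f<L
      f+[L∸f]≡L : f + suc (L ∸ suc f) ≡ L
      f+[L∸f]≡L = trans (cong (f +_) (sym L∸f≡)) (m+[n∸m]≡n (<⇒≤ f<L))
      β∸1∸[L∸f] : β ∸ 1 ∸ (L ∸ f) ≡ β ∸ (suc L ∸ f)
      β∸1∸[L∸f] = trans (∸-+-assoc β 1 (L ∸ f)) (cong (β ∸_) (sym (+-∸-assoc 1 (<⇒≤ f<L))))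

  window : ℕ → ℕ → List ℕ
  window f zero    = digit f ∷ []
  window f (suc k) = digit (f + suc k) ∷ window f k

  subword-window : ∀ f k → k < length (drop f ds) → reverse (take (suc k) (drop f ds)) ≡ window f k
  subword-window f k k<n = begin
    reverse (take (suc k) (drop f ds))                               ≡⟨ cong reverse (take-suc (drop f ds) k k<n) ⟩
    reverse (take k (drop f ds) ++ digitAt (drop f ds) k ∷ [])         ≡⟨ reverse-++ (take k (drop f ds)) _ ⟩
    digitAt (drop f ds) k ∷ reverse (take k (drop f ds))             ≡⟨ top k k<n ⟩
    window f k                                                       ∎
    where
    open ≡-Reasoning
    top : ∀ k → k < length (drop f ds) → digitAt (drop f ds) k ∷ reverse (take k (drop f ds)) ≡ window f k
    top zero    _   = cong (_∷ []) (trans (digitAt-drop ds f 0) (cong digit (+-identityʳ f)))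
    top (suc k) k<n = cong₂ _∷_ (digitAt-drop ds f (suc k)) (subword-window f k (<-trans (n<1+n k) k<n))

  windowProduct : ℕ → ℕ → ℕ
  windowProduct f zero    = suc (digit f)
  windowProduct f (suc k) = windowProduct f k * suc (digit (f + suc k))

  prefixProduct : ℕ → ℕ
  prefixProduct zero    = 1
  prefixProduct (suc L) = prefixProduct L * suc (digit L)

  prefixProduct-+ : ∀ f k → prefixProduct (f + suc k) ≡ prefixProduct f * windowProduct f k
  prefixProduct-+ f zero    = cong prefixProduct (+-comm f 1)
  prefixProduct-+ f (suc k) = trans (cong prefixProduct (+-suc f (suc k)))
    (trans (cong (_* suc (digit (f + suc k))) (prefixProduct-+ f k)) (*-assoc (prefixProduct f) _ _))

  prefixProduct≡product : ∀ L → L ≤ length ds → prefixProduct L ≡ product (map suc (take L ds))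
  prefixProduct≡product zero    _   = refl
  prefixProduct≡product (suc L) L<n = begin
    prefixProduct L * suc (digit L)                              ≡⟨ cong₂ _*_ (prefixProduct≡product L (<⇒≤ L<n)) (sym (*-identityʳ _)) ⟩
    product (map suc (take L ds)) * product (suc (digit L) ∷ [])     ≡⟨ product-++ (map suc (take L ds)) _ ⟨
    product (map suc (take L ds) ++ suc (digit L) ∷ [])             ≡⟨ cong product (map-++ suc (take L ds) _) ⟨
    product (map suc (take L ds ++ digit L ∷ []))                   ≡⟨ cong (product ∘′ map suc) (take-suc ds L L<n) ⟨
    product (map suc (take (suc L) ds))                            ∎
    where open ≡-Reasoning

  p∸d∸1 : ∀ d → p ∸ d ∸ 1 ≡ digitWeight false true d
  p∸d∸1 d = trans (∸-+-assoc p d 1) (cong (p ∸_) (+-comm d 1))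

  private
    open +-*-Solver
    swap-middle : ∀ w x y z → w *ℚ x *ℚ (y *ℚ z) ≡ x *ℚ y *ℚ (w *ℚ z)
    swap-middle = solve 4 (λ w x y z → w :* x :* (y :* z) := x :* y :* (w :* z)) refl
    rotate : ∀ x y z → x *ℚ y *ℚ z ≡ y *ℚ z *ℚ x
    rotate = solve 3 (λ x y z → x :* y :* z := y :* z :* x) refl

  cTail-∷-window : ∀ d f k → cTail p (d ∷ window f k) ≡ (ℤ.+ (p ∸ d) ℚ./ suc d) *ℚ cTail p (window f k)
  cTail-∷-window d f zero    = refl
  cTail-∷-window d f (suc k) = refl

  c-∷-window : ∀ d f k → c p (d ∷ window f k) ≡ (ℤ.+ d ℚ./ suc d) *ℚ cTail p (window f k)
  c-∷-window d f zero    = refl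
  c-∷-window d f (suc k) = refl

  cTail-window : ∀ f k → toℚ (windowProduct f k) *ℚ cTail p (window f k) ≡ toℚ (runWeight f k)
  cTail-window f zero    = trans (toℚ-*-/ (p ∸ digit f ∸ 1) (digit f)) (cong toℚ (p∸d∸1 (digit f)))
  cTail-window f (suc k) = begin
    toℚ (windowProduct f k * suc d) *ℚ cTail p (d ∷ window f k)          ≡⟨ cong₂ _*ℚ_ (toℚ-* (windowProduct f k) (suc d)) (cTail-∷-window d f k) ⟩
    toℚ (windowProduct f k) *ℚ toℚ (suc d) *ℚ (q *ℚ cTail p (window f k))   ≡⟨ swap-middle (toℚ (windowProduct f k)) (toℚ (suc d)) q (cTail p (window f k)) ⟩
    toℚ (suc d) *ℚ q *ℚ (toℚ (windowProduct f k) *ℚ cTail p (window f k))   ≡⟨ cong₂ _*ℚ_ (toℚ-*-/ (p ∸ d) d) (cTail-window f k) ⟩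
    toℚ (p ∸ d) *ℚ toℚ (runWeight f k)                                    ≡⟨ toℚ-* (p ∸ d) (runWeight f k) ⟨
    toℚ (runWeight f (suc k))                                            ∎
    where
    open ≡-Reasoning
    d : ℕ
    d = digit (f + suc k)
    q : ℚ
    q = ℤ.+ (p ∸ d) ℚ./ suc d

  c-window : ∀ f k → toℚ (windowProduct f (suc k)) *ℚ c p (window f (suc k)) ≡ toℚ (digit (f + suc k) * runWeight f k)
  c-window f k = begin
    toℚ (windowProduct f k * suc d) *ℚ c p (d ∷ window f k)             ≡⟨ cong₂ _*ℚ_ (toℚ-* (windowProduct f k) (suc d)) (c-∷-window d f k) ⟩
    toℚ (windowProduct f k) *ℚ toℚ (suc d) *ℚ (q *ℚ cTail p (window f k)) ≡⟨ swap-middle (toℚ (windowProduct f k)) (toℚ (suc d)) q (cTail p (window f k)) ⟩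
    toℚ (suc d) *ℚ q *ℚ (toℚ (windowProduct f k) *ℚ cTail p (window f k)) ≡⟨ cong₂ _*ℚ_ (toℚ-*-/ d d) (cTail-window f k) ⟩
    toℚ d *ℚ toℚ (runWeight f k)                                        ≡⟨ toℚ-* d (runWeight f k) ⟨
    toℚ (d * runWeight f k)                                             ∎
    where
    open ≡-Reasoning
    d : ℕ
    d = digit (f + suc k)
    q : ℚ
    q = ℤ.+ d ℚ./ suc d

  prefixProduct*c-subword : ∀ {f L} → f < L → L < length ds →
    toℚ (prefixProduct (suc L)) *ℚ c p (subword ds (L , f)) ≡ toℚ (digit L * runWeight f (L ∸ suc f)) *ℚ toℚ (prefixProduct f)
  prefixProduct*c-subword {f} {L} f<L L<n = begin
    toℚ (prefixProduct (suc L)) *ℚ c p (reverse (take (suc (L ∸ f)) (drop f ds)))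
      ≡⟨ cong₂ (λ i j → toℚ (prefixProduct i) *ℚ c p (reverse (take (suc j) (drop f ds)))) (sym f+2+k≡1+L) L∸f≡1+k ⟩
    toℚ (prefixProduct (f + suc (suc k))) *ℚ c p (reverse (take (suc (suc k)) (drop f ds)))
      ≡⟨ cong₂ (λ n w → toℚ n *ℚ c p w) (prefixProduct-+ f (suc k)) (subword-window f (suc k) 1+k<n) ⟩
    toℚ (prefixProduct f * windowProduct f (suc k)) *ℚ c p (window f (suc k))
      ≡⟨ cong (_*ℚ c p (window f (suc k))) (toℚ-* (prefixProduct f) (windowProduct f (suc k))) ⟩
    toℚ (prefixProduct f) *ℚ toℚ (windowProduct f (suc k)) *ℚ c p (window f (suc k))
      ≡⟨ rotate (toℚ (prefixProduct f)) (toℚ (windowProduct f (suc k))) (c p (window f (suc k))) ⟩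
    toℚ (windowProduct f (suc k)) *ℚ c p (window f (suc k)) *ℚ toℚ (prefixProduct f)
      ≡⟨ cong (_*ℚ toℚ (prefixProduct f)) (c-window f k) ⟩
    toℚ (digit (f + suc k) * runWeight f k) *ℚ toℚ (prefixProduct f)
      ≡⟨ cong (λ i → toℚ (digit i * runWeight f k) *ℚ toℚ (prefixProduct f)) f+1+k≡L ⟩
    toℚ (digit L * runWeight f k) *ℚ toℚ (prefixProduct f) ∎
    where
    open ≡-Reasoning
    k : ℕ
    k = L ∸ suc f
    L∸f≡1+k : L ∸ f ≡ suc k
    L∸f≡1+k = +-∸-assoc 1 f<L
    f+1+k≡L : f + suc k ≡ L
    f+1+k≡L = trans (cong (λ j → f + j) (sym L∸f≡1+k)) (m+[n∸m]≡n (<⇒≤ f<L))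
    f+2+k≡1+L : f + suc (suc k) ≡ suc L
    f+2+k≡1+L = trans (+-suc f (suc k)) (cong suc f+1+k≡L)
    1+k<n : suc k < length (drop f ds)
    1+k<n = subst₂ _<_ L∸f≡1+k (sym (length-drop f ds)) (∸-monoˡ-< L<n (<⇒≤ f<L))

  weight : Subwords → ℚ
  weight Q = Πℚ (map (λ v → c p (subword ds v)) Q)

  chainSum : ℕ → ℕ → ℚ
  chainSum L β = Σℚ (map weight (chains L β))

  headedSum : ℕ → ℕ → ℕ → ℚ
  headedSum i F β = Σℚ (map weight (headed i F β))

  Σℚ-weight-∷ : ∀ v Qs → Σℚ (map weight (map (v ∷_) Qs)) ≡ c p (subword ds v) *ℚ Σℚ (map weight Qs)
  Σℚ-weight-∷ v []       = sym (ℚ.*-zeroʳ (c p (subword ds v)))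
  Σℚ-weight-∷ v (Q ∷ Qs) = trans (cong (c p (subword ds v) *ℚ weight Q +ℚ_) (Σℚ-weight-∷ v Qs)) (sym (ℚ.*-distribˡ-+ (c p (subword ds v)) _ _))

  chainSum-identity : ∀ L → L ≤ length ds → ∀ β → toℚ (prefixProduct L) *ℚ chainSum L β ≡ toℚ (prefixPaths false L β)
  headedSum-identity : ∀ i F → F ≤ i → i < length ds → ∀ β →
    toℚ (prefixProduct (suc i)) *ℚ headedSum i F β ≡ toℚ (digit i * ∑[ f < F ] (runWeight f (i ∸ suc f) * prefixPaths false f (β ∸ (i ∸ f))))

  chainSum-identity zero    _   zero    = refl
  chainSum-identity zero    _   (suc β) = refl
  chainSum-identity (suc L) L<n β = begin
    toℚ (prefixProduct L * suc d) *ℚ Σℚ (map weight (chains L β ++ headed L L β))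
      ≡⟨ cong (toℚ (prefixProduct L * suc d) *ℚ_) (Σℚ-map-++ weight (chains L β) (headed L L β)) ⟩
    toℚ (prefixProduct L * suc d) *ℚ (chainSum L β +ℚ headedSum L L β)
      ≡⟨ ℚ.*-distribˡ-+ (toℚ (prefixProduct L * suc d)) (chainSum L β) (headedSum L L β) ⟩
    toℚ (prefixProduct L * suc d) *ℚ chainSum L β +ℚ toℚ (prefixProduct (suc L)) *ℚ headedSum L L β
      ≡⟨ cong₂ _+ℚ_ old (headedSum-identity L L ≤-refl L<n β) ⟩
    toℚ (suc d * A L β) +ℚ toℚ (d * ∑[ f < L ] (runWeight f (L ∸ suc f) * A f (β ∸ (L ∸ f))))
      ≡⟨ toℚ-+ (suc d * A L β) (d * ∑[ f < L ] (runWeight f (L ∸ suc f) * A f (β ∸ (L ∸ f)))) ⟨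
    toℚ (suc d * A L β + d * ∑[ f < L ] (runWeight f (L ∸ suc f) * A f (β ∸ (L ∸ f))))
      ≡⟨ cong (λ x → toℚ (suc d * A L β + d * x)) (prefixPaths-true L (<⇒≤ L<n) β) ⟨
    toℚ (suc d * A L β + d * prefixPaths true L β)
      ≡⟨ cong toℚ (prefixPaths-suc false L β L<n) ⟨
    toℚ (A (suc L) β) ∎
    where
    open ≡-Reasoning
    A : ℕ → ℕ → ℕ
    A = prefixPaths false
    d : ℕ
    d = digit L
    old : toℚ (prefixProduct L * suc d) *ℚ chainSum L β ≡ toℚ (suc d * A L β)
    old = begin
      toℚ (prefixProduct L * suc d) *ℚ chainSum L β
        ≡⟨ cong (_*ℚ chainSum L β) (trans (cong toℚ (*-comm (prefixProduct L) (suc d))) (toℚ-* (suc d) (prefixProduct L))) ⟩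
      toℚ (suc d) *ℚ toℚ (prefixProduct L) *ℚ chainSum L β
        ≡⟨ ℚ.*-assoc (toℚ (suc d)) (toℚ (prefixProduct L)) (chainSum L β) ⟩
      toℚ (suc d) *ℚ (toℚ (prefixProduct L) *ℚ chainSum L β)
        ≡⟨ cong (toℚ (suc d) *ℚ_) (chainSum-identity L (<⇒≤ L<n) β) ⟩
      toℚ (suc d) *ℚ toℚ (A L β)
        ≡⟨ toℚ-* (suc d) (A L β) ⟨
      toℚ (suc d * A L β) ∎

  headedSum-identity i zero    _   _   β = trans (ℚ.*-zeroʳ (toℚ (prefixProduct (suc i)))) (cong toℚ (sym (*-zeroʳ (digit i))))
  headedSum-identity i (suc F) F<i i<n β = begin
    toℚ (prefixProduct (suc i)) *ℚ Σℚ (map weight (headed i F β ++ map ((i , F) ∷_) (chains F β′)))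
      ≡⟨ cong (toℚ (prefixProduct (suc i)) *ℚ_) (trans (Σℚ-map-++ weight (headed i F β) (map ((i , F) ∷_) (chains F β′)))
                                                        (cong (headedSum i F β +ℚ_) (Σℚ-weight-∷ (i , F) (chains F β′)))) ⟩
    toℚ (prefixProduct (suc i)) *ℚ (headedSum i F β +ℚ c p (subword ds (i , F)) *ℚ chainSum F β′)
      ≡⟨ ℚ.*-distribˡ-+ (toℚ (prefixProduct (suc i))) (headedSum i F β) (c p (subword ds (i , F)) *ℚ chainSum F β′) ⟩
    toℚ (prefixProduct (suc i)) *ℚ headedSum i F β +ℚ toℚ (prefixProduct (suc i)) *ℚ (c p (subword ds (i , F)) *ℚ chainSum F β′)
      ≡⟨ cong₂ _+ℚ_ (headedSum-identity i F (≤-trans (n≤1+n F) F<i) i<n β) last ⟩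
    toℚ (d * ∑< F X) +ℚ toℚ (d * X F)
      ≡⟨ toℚ-+ (d * ∑< F X) (d * X F) ⟨
    toℚ (d * ∑< F X + d * X F)
      ≡⟨ cong toℚ (*-distribˡ-+ d (∑< F X) (X F)) ⟨
    toℚ (d * ∑< (suc F) X) ∎
    where
    open ≡-Reasoning
    β′ : ℕ
    β′ = β ∸ (i ∸ F)
    d : ℕ
    d = digit i
    X : ℕ → ℕ
    X f = runWeight f (i ∸ suc f) * prefixPaths false f (β ∸ (i ∸ f))
    last : toℚ (prefixProduct (suc i)) *ℚ (c p (subword ds (i , F)) *ℚ chainSum F β′) ≡ toℚ (d * X F)
    last = begin
      toℚ (prefixProduct (suc i)) *ℚ (c p (subword ds (i , F)) *ℚ chainSum F β′)
        ≡⟨ ℚ.*-assoc (toℚ (prefixProduct (suc i))) (c p (subword ds (i , F))) (chainSum F β′) ⟨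
      toℚ (prefixProduct (suc i)) *ℚ c p (subword ds (i , F)) *ℚ chainSum F β′
        ≡⟨ cong (_*ℚ chainSum F β′) (prefixProduct*c-subword F<i i<n) ⟩
      toℚ (d * runWeight F (i ∸ suc F)) *ℚ toℚ (prefixProduct F) *ℚ chainSum F β′
        ≡⟨ ℚ.*-assoc (toℚ (d * runWeight F (i ∸ suc F))) (toℚ (prefixProduct F)) (chainSum F β′) ⟩
      toℚ (d * runWeight F (i ∸ suc F)) *ℚ (toℚ (prefixProduct F) *ℚ chainSum F β′)
        ≡⟨ cong (toℚ (d * runWeight F (i ∸ suc F)) *ℚ_) (chainSum-identity F (<⇒≤ (<-trans F<i i<n)) β′) ⟩
      toℚ (d * runWeight F (i ∸ suc F)) *ℚ toℚ (prefixPaths false F β′)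
        ≡⟨ toℚ-* (d * runWeight F (i ∸ suc F)) (prefixPaths false F β′) ⟨
      toℚ (d * runWeight F (i ∸ suc F) * prefixPaths false F β′)
        ≡⟨ cong toℚ (*-assoc d _ _) ⟩
      toℚ (d * X F) ∎

module Expansion {p : ℕ} (p-prime : Prime p) (α n : ℕ)
  (S : ℕ → List (List ℕ)) (S-unique : ∀ γ → Unique (S γ)) (∈S⇔ : ∀ γ P → (P ∈ S γ) ⇔ InS α γ P)
  (N : List ℕ → List Subwords) (N-unique : ∀ P → Unique (N P)) (∈N⇔ : ∀ P Q → (Q ∈ N P) ⇔ InN p n P Q) where

  open Counting p-prime
  open DigitWindows p-prime (digits p n)
  open Descending

  ds : List ℕ
  ds = digits p n
  L : ℕ
  L = length ds

  enough⇔excess<α : ∀ Q → excess Q + length Q + 1 ≤ length Q + α ⇔ excess Q < α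
  enough⇔excess<α Q = mk⇔ (+-cancelˡ-≤ (length Q) (suc (excess Q)) α ∘ subst (_≤ length Q + α) regroup)
                          (subst (_≤ length Q + α) (sym regroup) ∘ +-monoʳ-≤ (length Q))
    where
    regroup : excess Q + length Q + 1 ≡ length Q + suc (excess Q)
    regroup = shuffle (excess Q) (length Q)
      where
      shuffle : ∀ e l → e + l + 1 ≡ l + suc e
      shuffle = solve-∀

  families : ℕ → List Subwords
  families γ = concatMap N (S γ)

  enumerated : List Subwords
  enumerated = concatMap families (upTo (2 * α ∸ 1))

  ∈enumerated⇒admissible : ∀ {Q} → Q ∈ enumerated → Admissible L α Q
  ∈enumerated⇒admissible {Q} Q∈ with Equivalence.to (∈-concatMap⇔ families {upTo (2 * α ∸ 1)}) Q∈
  ... | γ , _ , Q∈γ with Equivalence.to (∈-concatMap⇔ N {S γ}) Q∈γ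
  ... | P , P∈ , Q∈P = admissible (InN.nonoverlap inN) (lengths≥2⇒long Q (All-resp-↭ (↭-sym (InN.lengths inN)) (InS.parts≥2 inS))) excess<α
    where
    inS : InS α γ P
    inS = Equivalence.to (∈S⇔ γ P) P∈
    inN : InN p n P Q
    inN = Equivalence.to (∈N⇔ P Q) Q∈P
    γ≡ : γ ≡ excess Q + length Q
    γ≡ = trans (sym (InS.sums inS)) (trans (sym (sum-↭ (InN.lengths inN))) (sum-lengths Q))
    |P|≡|Q| : length P ≡ length Q
    |P|≡|Q| = trans (sym (↭-length (InN.lengths inN))) (List.length-map lengthSW Q)
    excess<α : excess Q < α
    excess<α = Equivalence.to (enough⇔excess<α Q) (subst₂ (λ g l → g + 1 ≤ l + α) γ≡ |P|≡|Q| (InS.enough inS))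

  admissible⇒∈enumerated : ∀ {Q} → Admissible L α Q → Q ∈ enumerated
  admissible⇒∈enumerated {Q} (admissible ch long excess<α) =
    Equivalence.from (∈-concatMap⇔ families) (γ , ∈-upTo⁺ γ<2α-1 ,
      Equivalence.from (∈-concatMap⇔ N) (P , Equivalence.from (∈S⇔ γ P) inS , Equivalence.from (∈N⇔ P Q) inN))
    where
    γ : ℕ
    γ = sum (map lengthSW Q)
    P : List ℕ
    P = sortDesc (map lengthSW Q)
    inN : InN p n P Q
    inN = record { nonoverlap = ch ; lengths = ↭-sym (sortDesc-↭ (map lengthSW Q)) }
    |P|≡|Q| : length P ≡ length Q
    |P|≡|Q| = trans (↭-length (sortDesc-↭ (map lengthSW Q))) (List.length-map lengthSW Q)
    inS : InS α γ P
    inS = record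
      { sorted  = sortDesc-nonIncr (map lengthSW Q)
      ; parts≥2 = All-resp-↭ (↭-sym (sortDesc-↭ (map lengthSW Q))) (long⇒lengths≥2 long)
      ; sums    = sum-↭ (sortDesc-↭ (map lengthSW Q))
      ; enough  = subst₂ (λ g l → g + 1 ≤ l + α) (sym (sum-lengths Q)) (sym |P|≡|Q|) (Equivalence.from (enough⇔excess<α Q) excess<α)
      }
    γ<2α-1 : γ < 2 * α ∸ 1
    γ<2α-1 = ≤-<-trans (sum-lengths≤2*excess long) (2*e<2*α∸1 excess<α)

  enumerated-unique : Unique enumerated
  enumerated-unique = concatMap-unique families (Unique.upTo⁺ (2 * α ∸ 1))
    (λ {γ} _ → concatMap-unique N (S-unique γ) (λ {P} _ → N-unique P) samePartition)
    sameSize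
    where
    samePartition : ∀ {γ P P′ Q} → P ∈ S γ → P′ ∈ S γ → Q ∈ N P → Q ∈ N P′ → P ≡ P′
    samePartition {γ} {P} {P′} {Q} P∈ P′∈ Q∈P Q∈P′ = nonIncr-↭⇒≡
      (InS.sorted (Equivalence.to (∈S⇔ γ P) P∈)) (InS.sorted (Equivalence.to (∈S⇔ γ P′) P′∈))
      (↭-trans (↭-sym (InN.lengths (Equivalence.to (∈N⇔ P Q) Q∈P))) (InN.lengths (Equivalence.to (∈N⇔ P′ Q) Q∈P′)))
    size : ∀ {γ Q} → Q ∈ families γ → γ ≡ sum (map lengthSW Q)
    size {γ} {Q} Q∈ with Equivalence.to (∈-concatMap⇔ N) Q∈
    ... | P , P∈ , Q∈P = trans (sym (InS.sums (Equivalence.to (∈S⇔ γ P) P∈))) (sym (sum-↭ (InN.lengths (Equivalence.to (∈N⇔ P Q) Q∈P))))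
    sameSize : ∀ {γ γ′ Q} → γ ∈ upTo (2 * α ∸ 1) → γ′ ∈ upTo (2 * α ∸ 1) → Q ∈ families γ → Q ∈ families γ′ → γ ≡ γ′
    sameSize _ _ Q∈γ Q∈γ′ = trans (size Q∈γ) (sym (size Q∈γ′))

  enumeratedSum : ℚ
  enumeratedSum = Σℚ (map (λ γ → Σℚ (map (λ P → Σℚ (map weight (N P))) (S γ))) (upTo (2 * α ∸ 1)))

  chainSum≡enumeratedSum : chainSum L α ≡ enumeratedSum
  chainSum≡enumeratedSum = begin
    Σℚ (map weight (chains L α))
      ≡⟨ Σℚ-map-unique weight (chains-unique L α) enumerated-unique
           (mk⇔ (admissible⇒∈enumerated ∘ ∈chains⇒admissible) (admissible⇒∈chains ∘ ∈enumerated⇒admissible)) ⟩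
    Σℚ (map weight enumerated)
      ≡⟨ Σℚ-map-concatMap weight families (upTo (2 * α ∸ 1)) ⟩
    Σℚ (map (λ γ → Σℚ (map weight (families γ))) (upTo (2 * α ∸ 1)))
      ≡⟨ cong Σℚ (List.map-cong (λ γ → Σℚ-map-concatMap weight N (S γ)) (upTo (2 * α ∸ 1))) ⟩
    Σℚ (map (λ γ → Σℚ (map (λ P → Σℚ (map weight (N P))) (S γ))) (upTo (2 * α ∸ 1))) ∎
    where open ≡-Reasoning

  a≡expansion : toℚ (a p α n) ≡ toℚ (product (map suc ds)) *ℚ enumeratedSum
  a≡expansion = begin
    toℚ (a p α n)
      ≡⟨ cong toℚ (trans (a≡count α n) (count≡carryPaths false n α)) ⟩
    toℚ (carryPaths false false ds α)
      ≡⟨ cong (λ xs → toℚ (carryPaths false false xs α)) take-all ⟨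
    toℚ (prefixPaths false L α)
      ≡⟨ chainSum-identity L ≤-refl α ⟨
    toℚ (prefixProduct L) *ℚ chainSum L α
      ≡⟨ cong₂ (λ k s → toℚ k *ℚ s) (trans (prefixProduct≡product L ≤-refl) (cong (product ∘ map suc) take-all)) chainSum≡enumeratedSum ⟩
    toℚ (product (map suc ds)) *ℚ enumeratedSum ∎
    where
    open ≡-Reasoning
    take-all : take L ds ≡ ds
    take-all = List.take-all L ds ≤-refl

theorem1 : (p : ℕ) → Prime p → (α n : ℕ) →
    (S : ℕ → List (List ℕ)) → (∀ γ → Unique (S γ)) →
    (∀ γ P → (P ∈ S γ) ⇔ InS α γ P) →
    (N : List ℕ → List (List (ℕ × ℕ))) → (∀ P → Unique (N P)) →
    (∀ P Q → (Q ∈ N P) ⇔ InN p n P Q) →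
    toℚ (a p α n)
      ≡ toℚ (product (map suc (digits p n)))
        *ℚ Σℚ (map (λ γ → Σℚ (map (λ P → Σℚ (map (λ Q → Πℚ (map (λ v → c p (subword (digits p n) v)) Q)) (N P))) (S γ)))
                  (upTo (2 * α ∸ 1)))
theorem1 p p-prime α n = Expansion.a≡expansion p-prime α n
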